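{- Let $G$ be a bipartite matching covered graph and $M$ a perfect matching of $G$. Then $\mathrm{pmw}_M(G)=\mathrm{cycw}(D(G,M))$.
   Context: A graph is matching covered if it is connected and every edge lies in a perfect matching. For $X\subseteq V(G)$, $\partial(X)$ is the set of edges (arcs in a digraph) with exactly one endpoint in $X$; $\mathrm{mp}(\partial(X))=\max_N|N\cap\partial(X)|$ over perfect matchings $N$ of $G$. A perfect matching decomposition of $G$ is $(T,\delta)$ with $T$ a cubic tree and $\delta$ a bijection from leaves of $T$ to $V(G)$; for $e\in E(T)$, $\partial(e)$ is the cut whose shore is the $\delta$-image of the leaves of one component of $T-e$; its width is $\max_e\mathrm{mp}(\partial(e))$. A set $S$ is $M$-conformal if the edges of $M$ inside $V(G)\setminus S$ form a perfect matching of $G-S$ and those inside $S$ a perfect matching of $G[S]$. $\mathrm{pmw}_M(G)$ is the smallest width of a perfect matching decomposition $(T,\delta)$ such that for every inner edge $e$ of $T$ (not incident with a leaf) the $\delta$-images of the leaves of both components of $T-e$ are $M$-conformal. For bipartite $G=(A\cup B,E)$ with $M=\{a_1b_1,\dots,a_mb_m\}$, $a_i\in A$, $b_i\in B$, the $M$-direction $D(G,M)$ has vertices $v_1,\dots,v_m$ and arcs $(v_i,v_j)$, $i\ne j$, whenever $a_ib_j\in E$. A cycle decomposition of a digraph $D$ is $(T,\varphi)$, $T$ a cubic tree, $\varphi$ a bijection from leaves of $T$ to $V(D)$; for $e\in E(T)$ the cycle porosity of $\partial(e)$ is the maximum over families $\mathcal{C}$ of pairwise vertex-disjoint directed cycles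 of $D$ of $|\partial(e)\cap\bigcup_{C\in\mathcal{C}}E(C)|$; width is the maximum over tree edges and $\mathrm{cycw}(D)$ is the minimum width. -}

module Defs where

open import Data.Nat using (ℕ; zero; suc; _+_; _≤_)
open import Data.Bool using (Bool; true; false; not; _xor_; if_then_else_)
open import Data.Fin using (Fin)
import Data.Fin as F
open import Data.Sum using (_⊎_; inj₁; inj₂)
open import Data.Product using (Σ; ∃; _×_; _,_)
open import Data.List using (List; []; _∷_; _++_; length; concatMap)
open import Data.Bool.ListAction using (any)
open import Data.List.Membership.Propositional using (_∈_; _∉_)
open import Data.List.Relation.Unary.All using (All)
open import Data.List.Relation.Unary.AllPairs using (AllPairs)
open import Data.List.Relation.Unary.Unique.Propositional using (Unique)
open import Data.Empty using (⊥)
open import Relation.Binary.Definitions using (DecidableEquality)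
open import Relation.Binary.PropositionalEquality using (_≡_; _≢_)
open import Relation.Nullary.Decidable using (⌊_⌋)
open import Function.Definitions using (Injective)

countFin : {m : ℕ} → (Fin m → Bool) → ℕ
countFin {zero}  f = 0
countFin {suc m} f = (if f F.zero then 1 else 0) + countFin (λ i → f (F.suc i))

countList : {A : Set} → (A → Bool) → List A → ℕ
countList p []       = 0
countList p (x ∷ xs) = (if p x then 1 else 0) + countList p xs

-- A cubic tree with at least two leaves is encoded by choosing one leaf
-- (the "root leaf") and describing the rest of the tree as a binary tree
-- hanging from the unique neighbour of the root leaf.
--   * tree edges  <->  subtrees s of `body` (the edge from the top node of s
--     to its parent; for s = body the parent is the root leaf);
--   * the shore of that edge is the set of leaf labels of s;
--   * an edge is inner (not incident with a leaf of T) iff s is an internal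
--     node and s ≠ body.

data BTree (V : Set) : Set where
  leaf : V → BTree V
  node : BTree V → BTree V → BTree V

leaves : {V : Set} → BTree V → List V
leaves (leaf v)   = v ∷ []
leaves (node l r) = leaves l ++ leaves r

subtrees : {V : Set} → BTree V → List (BTree V)
subtrees (leaf v)   = leaf v ∷ []
subtrees (node l r) = node l r ∷ subtrees l ++ subtrees r

nodeSubtrees : {V : Set} → BTree V → List (BTree V)
nodeSubtrees (leaf v)   = []
nodeSubtrees (node l r) = node l r ∷ nodeSubtrees l ++ nodeSubtrees r

innerSubtrees : {V : Set} → BTree V → List (BTree V)
innerSubtrees (leaf v)   = []
innerSubtrees (node l r) = nodeSubtrees l ++ nodeSubtrees r

record Decomp (V : Set) : Set where
  constructor mkDecomp
  field
    root  : V
    body  : BTree V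
    uniq  : Unique (root ∷ leaves body)
    cover : ∀ v → v ∈ (root ∷ leaves body)
open Decomp public

shore : {V : Set} → DecidableEquality V → BTree V → V → Bool
shore _≟_ s v = any (λ u → ⌊ u ≟ v ⌋) (leaves s)

-- Bipartite graphs G = (A ∪ B, E) with A = {a_0..a_{m-1}}, B = {b_0..b_{m-1}}.
-- E i j = true  iff  a_i b_j ∈ E(G).  Vertices: inj₁ i = a_i, inj₂ j = b_j.


VG : ℕ → Set
VG m = Fin m ⊎ Fin m

_≟G_ : {m : ℕ} → DecidableEquality (VG m)
_≟G_ = Data.Sum.Properties.≡-dec F._≟_ F._≟_
  where import Data.Sum.Properties

Adj : {m : ℕ} → (Fin m → Fin m → Bool) → VG m → VG m → Set
Adj E (inj₁ i) (inj₂ j) = E i j ≡ true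
Adj E (inj₂ j) (inj₁ i) = E i j ≡ true
Adj E (inj₁ _) (inj₁ _) = ⊥
Adj E (inj₂ _) (inj₂ _) = ⊥

data Reach {m : ℕ} (E : Fin m → Fin m → Bool) : VG m → VG m → Set where
  here : ∀ {u} → Reach E u u
  step : ∀ {u v w} → Adj E u v → Reach E v w → Reach E u w

Connected : {m : ℕ} → (Fin m → Fin m → Bool) → Set
Connected E = ∀ u v → Reach E u v

-- perfect matchings of a bipartite graph: π matches a_i with b_{π i};
-- π injective (hence bijective on Fin m), and every a_i b_{π i} ∈ E(G)
IsPM : {m : ℕ} → (Fin m → Fin m → Bool) → (Fin m → Fin m) → Set
IsPM E π = Injective _≡_ _≡_ π × (∀ i → E i (π i) ≡ true)

MatchingCovered : {m : ℕ} → (Fin m → Fin m → Bool) → Set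
MatchingCovered E =
  Connected E × (∀ i j → E i j ≡ true → Σ (Fin _ → Fin _) λ π → IsPM E π × π i ≡ j)

cutPM : {m : ℕ} → (VG m → Bool) → (Fin m → Fin m) → ℕ
cutPM X π = countFin (λ i → X (inj₁ i) xor X (inj₂ (π i)))

MpAtMost : {m : ℕ} → (Fin m → Fin m → Bool) → (VG m → Bool) → ℕ → Set
MpAtMost E X k = ∀ π → IsPM E π → cutPM X π ≤ k

-- "the edges of M inside S form a perfect matching of G[S]", for the
-- perfect matching M = {a_i b_{μ i}}: every vertex of S is covered by
-- its M-edge with both ends in S
MCoversInside : {m : ℕ} → (Fin m → Fin m) → (VG m → Bool) → Set
MCoversInside μ S =
  (∀ i → S (inj₁ i) ≡ true → S (inj₂ (μ i)) ≡ true) ×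
  (∀ i → S (inj₂ (μ i)) ≡ true → S (inj₁ i) ≡ true)

Conformal : {m : ℕ} → (Fin m → Fin m) → (VG m → Bool) → Set
Conformal μ S = MCoversInside μ S × MCoversInside μ (λ v → not (S v))

PMWidthAtMost : {m : ℕ} → (Fin m → Fin m → Bool) → Decomp (VG m) → ℕ → Set
PMWidthAtMost E d k = All (λ s → MpAtMost E (shore _≟G_ s) k) (subtrees (body d))

MConformalDecomp : {m : ℕ} → (Fin m → Fin m) → Decomp (VG m) → Set
MConformalDecomp μ d =
  All (λ s → Conformal μ (shore _≟G_ s) × Conformal μ (λ v → not (shore _≟G_ s v)))
      (innerSubtrees (body d))

PmwM : {m : ℕ} → (Fin m → Fin m → Bool) → (Fin m → Fin m) → ℕ → Set
PmwM E μ w =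
  (Σ (Decomp (VG _)) λ d → MConformalDecomp μ d × PMWidthAtMost E d w) ×
  (∀ d k → MConformalDecomp μ d → PMWidthAtMost E d k → w ≤ k)

arcsGo : {V : Set} → V → List V → List (V × V)
arcsGo first []           = []
arcsGo first (x ∷ [])     = (x , first) ∷ []
arcsGo first (x ∷ y ∷ xs) = (x , y) ∷ arcsGo first (y ∷ xs)

cycleArcs : {V : Set} → List V → List (V × V)
cycleArcs []       = []
cycleArcs (x ∷ xs) = arcsGo x (x ∷ xs)

IsDirCycle : {n : ℕ} → (Fin n → Fin n → Set) → List (Fin n) → Set
IsDirCycle Arc c =
  2 ≤ length c × Unique c × All (λ uv → Arc (Data.Product.proj₁ uv) (Data.Product.proj₂ uv)) (cycleArcs c)

VertexDisjoint : {n : ℕ} → List (Fin n) → List (Fin n) → Set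
VertexDisjoint c c' = ∀ v → v ∈ c → v ∉ c'

IsCycleFamily : {n : ℕ} → (Fin n → Fin n → Set) → List (List (Fin n)) → Set
IsCycleFamily Arc cs = All (IsDirCycle Arc) cs × AllPairs VertexDisjoint cs

-- |∂(X) ∩ ⋃_{C ∈ 𝒞} E(C)| (arc sets of disjoint cycles are disjoint)
cutFamily : {n : ℕ} → (Fin n → Bool) → List (List (Fin n)) → ℕ
cutFamily X cs =
  countList (λ uv → X (Data.Product.proj₁ uv) xor X (Data.Product.proj₂ uv)) (concatMap cycleArcs cs)

PorosityAtMost : {n : ℕ} → (Fin n → Fin n → Set) → (Fin n → Bool) → ℕ → Set
PorosityAtMost Arc X k = ∀ cs → IsCycleFamily Arc cs → cutFamily X cs ≤ k

CycWidthAtMost : {n : ℕ} → (Fin n → Fin n → Set) → Decomp (Fin n) → ℕ → Set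
CycWidthAtMost Arc d k = All (λ s → PorosityAtMost Arc (shore F._≟_ s) k) (subtrees (body d))

Cycw : {n : ℕ} → (Fin n → Fin n → Set) → ℕ → Set
Cycw Arc w =
  (Σ (Decomp (Fin _)) λ d → CycWidthAtMost Arc d w) ×
  (∀ d k → CycWidthAtMost Arc d k → w ≤ k)

-- the M-direction D(G,M) for M = {a_i b_{μ i}}: vertex v_i stands for the
-- M-edge a_i b_{μ i}; arc (v_i,v_j) for i ≠ j whenever a_i b_{μ j} ∈ E(G)
MDirArc : {m : ℕ} → (Fin m → Fin m → Bool) → (Fin m → Fin m) → Fin m → Fin m → Set
MDirArc E μ i j = i ≢ j × E i (μ j) ≡ true

-- Vertex v_i of D(G,M) stands for the M-edge a_i b_(μ i). A perfect matching {a_j b_(π j)} of G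
-- corresponds to the permutation μ⁻¹ ∘ π of the v_j; its nontrivial cycles are disjoint directed cycles
-- of D, and every family of disjoint directed cycles arises this way. For a cut of G that is a union of
-- M-edges, the matching and the cycle family cross it equally often. Hence a cycle decomposition of D
-- expands, by splitting each leaf v_i into a cherry a_i, b_(μ i), into an M-conformal decomposition of G
-- of the same width: the new leaf cuts have width 1, and every cycle decomposition already has width
-- at least 1 because G is matching covered. Conversely, deleting the leaves b_j from an M-conformal
-- decomposition yields a cycle decomposition whose cuts are cuts of inner edges, except the singletons
-- {v_i}; each of those is also cut off by an inner edge, since the leaves a_i and b_(μ i) are separated
-- only by leaf edges.

module Submission where

open import Defs
open import Data.Nat using (ℕ; zero; suc; _+_; _≤_; _<_; z≤n; s≤s)
open import Data.Nat.Properties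
  using (+-identityʳ; +-comm; +-assoc; +-suc; +-mono-≤; +-monoˡ-≤; ≤-refl; ≤-reflexive; ≤-trans; ≤-pred;
         n≤1+n; m≤n+m; 1+n≰n; n≮0; m≤n⇒m<n∨m≡n; m≤n⇒∃[o]m+o≡n; +-commutativeSemigroup)
open import Data.Bool using (Bool; true; false; not; _xor_; if_then_else_; _∧_; _∨_)
open import Data.Bool.Properties using (xor-same; ∨-identityʳ)
open import Algebra.Properties.CommutativeSemigroup +-commutativeSemigroup using () renaming (interchange to +-interchange)
open import Data.Bool.ListAction using (any)
open import Data.Fin using (Fin; toℕ)
import Data.Fin as F
import Data.Fin.Properties as FP
open import Data.Sum using (_⊎_; inj₁; inj₂)
open import Data.Sum.Properties using (inj₁-injective; inj₂-injective)
open import Data.Product using (Σ; ∃; ∃₂; _×_; _,_; proj₁; proj₂)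
open import Data.Maybe using (Maybe; just; nothing)
open import Data.List using (List; []; _∷_; _++_; length; concatMap; map; concat; lookup)
open import Data.List.Properties using (++-identityʳ; map-∘; map-cong-local; length-++)
open import Data.List.Membership.Propositional using (_∈_; _∉_)
open import Data.List.Membership.Propositional.Properties using (∈-++⁺ˡ; ∈-++⁺ʳ; ∈-++⁻; ∈-map⁺; ∈-concat⁻′)
open import Data.List.Relation.Unary.Any using (here; there)
import Data.List.Relation.Unary.Any as Any
open import Data.List.Relation.Unary.Any.Properties using (lookup-index)
open import Data.List.Relation.Unary.All using (All; []; _∷_)
import Data.List.Relation.Unary.All as All
import Data.List.Relation.Unary.All.Properties as All
open import Data.List.Relation.Unary.All.Properties using (¬Any⇒All¬; All¬⇒¬Any)
open import Data.List.Relation.Unary.AllPairs using ([]; _∷_)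
import Data.List.Relation.Unary.AllPairs as AllPairs
open import Data.List.Relation.Unary.Unique.Propositional using (Unique)
import Data.List.Relation.Unary.Unique.Propositional.Properties as Unique
open import Data.List.Relation.Unary.Unique.Propositional.Properties using (Unique[x∷xs]⇒x∉xs)
open import Data.Empty using (⊥; ⊥-elim)
open import Relation.Binary.Definitions using (DecidableEquality)
open import Relation.Binary.PropositionalEquality
open import Relation.Nullary using (¬_; Dec; yes; no)
open import Relation.Nullary.Decidable using (⌊_⌋; ¬?)
open import Function.Base using (_∘_)
open import Function.Definitions using (Injective)
open import Function.Bundles using (_⇔_; mk⇔)

indicator : Bool → ℕ
indicator b = if b then 1 else 0

countFin-cong : ∀ {m} {f g : Fin m → Bool} → (∀ i → f i ≡ g i) → countFin f ≡ countFin g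
countFin-cong {zero}  h = refl
countFin-cong {suc m} h = cong₂ _+_ (cong indicator (h F.zero)) (countFin-cong (h ∘ F.suc))

countFin-split : ∀ {m} (f g h : Fin m → Bool) →
                 (∀ i → indicator (f i) ≡ indicator (g i) + indicator (h i)) →
                 countFin f ≡ countFin g + countFin h
countFin-split {zero}  f g h e = refl
countFin-split {suc m} f g h e =
  trans (cong₂ _+_ (e F.zero) (countFin-split (f ∘ F.suc) (g ∘ F.suc) (h ∘ F.suc) (e ∘ F.suc)))
        (+-interchange (indicator (g F.zero)) (indicator (h F.zero)) (countFin (g ∘ F.suc)) (countFin (h ∘ F.suc)))

countFin≡0 : ∀ {m} (f : Fin m → Bool) → (∀ i → f i ≡ false) → countFin f ≡ 0
countFin≡0 {zero}  f h = refl
countFin≡0 {suc m} f h rewrite h F.zero = countFin≡0 (f ∘ F.suc) (h ∘ F.suc)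

1≤countFin : ∀ {m} (f : Fin m → Bool) i → f i ≡ true → 1 ≤ countFin f
1≤countFin f F.zero    e rewrite e = s≤s z≤n
1≤countFin f (F.suc i) e =
  ≤-trans (1≤countFin (f ∘ F.suc) i e) (m≤n+m (countFin (f ∘ F.suc)) (indicator (f F.zero)))

countFin≤1 : ∀ {m} (f : Fin m → Bool) → (∀ i j → f i ≡ true → f j ≡ true → i ≡ j) → countFin f ≤ 1
countFin≤1 {zero}  f h = z≤n
countFin≤1 {suc m} f h with f F.zero in e
... | true = ≤-reflexive (cong suc (countFin≡0 (f ∘ F.suc) onlyZero))
  where
  onlyZero : ∀ i → f (F.suc i) ≡ false
  onlyZero i with f (F.suc i) in e'
  ... | true with () ← h F.zero (F.suc i) e e'
  ... | false = refl
... | false = countFin≤1 (f ∘ F.suc) (λ i j p q → FP.suc-injective (h (F.suc i) (F.suc j) p q))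

countFin-< : ∀ {m} (f g : Fin m → Bool) → (∀ i → f i ≡ true → g i ≡ true) →
             ∀ i → f i ≡ false → g i ≡ true → countFin f < countFin g
countFin-< f g f⊆g i fi gi =
  subst (countFin f <_) (sym split)
    (subst (suc (countFin f) ≤_) (+-comm (countFin rest) (countFin f)) (+-monoˡ-≤ (countFin f) 1≤rest))
  where
  rest : _ → Bool
  rest j = g j ∧ not (f j)
  split : countFin g ≡ countFin f + countFin rest
  split = countFin-split g f rest pointwise
    where
    pointwise : ∀ j → indicator (g j) ≡ indicator (f j) + indicator (rest j)
    pointwise j with f j in e | g j in e'
    ... | true  | true  = refl
    ... | true  | false with () ← trans (sym (f⊆g j e)) e'
    ... | false | true  = refl
    ... | false | false = refl
  1≤rest : 1 ≤ countFin rest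
  1≤rest = 1≤countFin rest i (subst (λ b → b ∧ not (f i) ≡ true) (sym gi) (cong not fi))

countList-++ : ∀ {A : Set} (p : A → Bool) xs ys → countList p (xs ++ ys) ≡ countList p xs + countList p ys
countList-++ p []       ys = refl
countList-++ p (x ∷ xs) ys rewrite countList-++ p xs ys = sym (+-assoc (indicator (p x)) (countList p xs) (countList p ys))

countList-map : ∀ {A B : Set} (p : B → Bool) (f : A → B) xs → countList p (map f xs) ≡ countList (p ∘ f) xs
countList-map p f []       = refl
countList-map p f (x ∷ xs) = cong (indicator (p (f x)) +_) (countList-map p f xs)

countList-cong : ∀ {A : Set} {p q : A → Bool} xs → (∀ x → p x ≡ q x) → countList p xs ≡ countList q xs
countList-cong []       h = refl
countList-cong (x ∷ xs) h = cong₂ _+_ (cong indicator (h x)) (countList-cong xs h)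

countList≡0 : ∀ {A : Set} (p : A → Bool) xs → (∀ x → p x ≡ false) → countList p xs ≡ 0
countList≡0 p []       h = refl
countList≡0 p (x ∷ xs) h rewrite h x = countList≡0 p xs h

⌊≟⌋-true : ∀ {A : Set} (_≟_ : DecidableEquality A) {a b : A} → a ≡ b → ⌊ a ≟ b ⌋ ≡ true
⌊≟⌋-true _≟_ {a} {b} e with a ≟ b
... | yes _ = refl
... | no ne = ⊥-elim (ne e)

⌊≟⌋-false : ∀ {A : Set} (_≟_ : DecidableEquality A) {a b : A} → a ≢ b → ⌊ a ≟ b ⌋ ≡ false
⌊≟⌋-false _≟_ {a} {b} ne with a ≟ b
... | yes e = ⊥-elim (ne e)
... | no _  = refl

≡⌊⌋ : ∀ {P : Set} (b : Bool) (d : Dec P) → (b ≡ true → P) → (P → b ≡ true) → b ≡ ⌊ d ⌋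
≡⌊⌋ true  (yes _)  _ _ = refl
≡⌊⌋ true  (no ¬p)  f _ = ⊥-elim (¬p (f refl))
≡⌊⌋ false (yes p)  _ g with () ← g p
≡⌊⌋ false (no _)   _ _ = refl

memB : ∀ {A : Set} → DecidableEquality A → A → List A → Bool
memB _≟_ v xs = any (λ u → ⌊ u ≟ v ⌋) xs

module _ {A : Set} (_≟_ : DecidableEquality A) where

  memB-true⇒∈ : ∀ v xs → memB _≟_ v xs ≡ true → v ∈ xs
  memB-true⇒∈ v (x ∷ xs) e with x ≟ v
  ... | yes refl = here refl
  ... | no _     = there (memB-true⇒∈ v xs e)

  ∈⇒memB-true : ∀ v xs → v ∈ xs → memB _≟_ v xs ≡ true
  ∈⇒memB-true v (x ∷ xs) (here refl) rewrite ⌊≟⌋-true _≟_ {x} refl = refl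
  ∈⇒memB-true v (x ∷ xs) (there p) with x ≟ v
  ... | yes _ = refl
  ... | no _  = ∈⇒memB-true v xs p

  ∉⇒memB-false : ∀ v xs → v ∉ xs → memB _≟_ v xs ≡ false
  ∉⇒memB-false v xs v∉ with memB _≟_ v xs in e
  ... | true  = ⊥-elim (v∉ (memB-true⇒∈ v xs e))
  ... | false = refl

  memB-false⇒∉ : ∀ v xs → memB _≟_ v xs ≡ false → v ∉ xs
  memB-false⇒∉ v xs e p with () ← trans (sym (∈⇒memB-true v xs p)) e

memB-cong : ∀ {A B : Set} (_≟₁_ : DecidableEquality A) (_≟₂_ : DecidableEquality B) v xs w ys →
            (v ∈ xs → w ∈ ys) → (w ∈ ys → v ∈ xs) → memB _≟₁_ v xs ≡ memB _≟₂_ w ys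
memB-cong _≟₁_ _≟₂_ v xs w ys f g with memB _≟₁_ v xs in e
... | true  = sym (∈⇒memB-true _≟₂_ w ys (f (memB-true⇒∈ _≟₁_ v xs e)))
... | false = sym (∉⇒memB-false _≟₂_ w ys (λ q → memB-false⇒∉ _≟₁_ v xs e (g q)))

countFin-≟ : ∀ {m} (x : Fin m) (q : Fin m → Bool) → countFin (λ j → ⌊ x F.≟ j ⌋ ∧ q j) ≡ indicator (q x)
countFin-≟ {suc m} F.zero q rewrite countFin≡0 (λ j → ⌊ F.zero F.≟ F.suc j ⌋ ∧ q (F.suc j)) (λ j → refl) =
  +-identityʳ (indicator (q F.zero))
countFin-≟ {suc m} (F.suc x) q = trans (countFin-cong pointwise) (countFin-≟ x (q ∘ F.suc))
  where
  pointwise : ∀ j → ⌊ F.suc x F.≟ F.suc j ⌋ ∧ q (F.suc j) ≡ ⌊ x F.≟ j ⌋ ∧ q (F.suc j)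
  pointwise j with x F.≟ j
  ... | yes refl = refl
  ... | no _     = refl

countFin-memB : ∀ {m} (c : List (Fin m)) (q : Fin m → Bool) → Unique c →
                countFin (λ j → memB F._≟_ j c ∧ q j) ≡ countList q c
countFin-memB {m} []       q u       = countFin≡0 {m} (λ j → false) (λ j → refl)
countFin-memB     (x ∷ xs) q (x∉ ∷ u) =
  trans (countFin-split _ (λ j → ⌊ x F.≟ j ⌋ ∧ q j) (λ j → memB F._≟_ j xs ∧ q j) pointwise)
        (cong₂ _+_ (countFin-≟ x q) (countFin-memB xs q u))
  where
  pointwise : ∀ j → indicator ((⌊ x F.≟ j ⌋ ∨ memB F._≟_ j xs) ∧ q j) ≡
                    indicator (⌊ x F.≟ j ⌋ ∧ q j) + indicator (memB F._≟_ j xs ∧ q j)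
  pointwise j with x F.≟ j
  ... | yes refl rewrite ∉⇒memB-false F._≟_ x xs (All¬⇒¬Any x∉) = sym (+-identityʳ _)
  ... | no _     = refl

injective⇒surjective : ∀ {m} (f : Fin m → Fin m) → Injective _≡_ _≡_ f → ∀ j → ∃ λ i → f i ≡ j
injective⇒surjective {suc n} f inj j with FP.any? (λ i → f i F.≟ j)
... | yes hit = hit
... | no miss = ⊥-elim (1+n≰n (FP.injective⇒≤ g-injective))
  where
  g : Fin (suc n) → Fin n
  g i = F.punchOut {i = j} {j = f i} (λ e → miss (i , sym e))
  g-injective : Injective _≡_ _≡_ g
  g-injective {a} {b} e = inj (FP.punchOut-injective (λ e' → miss (a , sym e')) (λ e' → miss (b , sym e')) e)

iter : ∀ {m} → (Fin m → Fin m) → ℕ → Fin m → Fin m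
iter σ zero    x = x
iter σ (suc n) x = σ (iter σ n x)

iter-+ : ∀ {m} (σ : Fin m → Fin m) a b x → iter σ (a + b) x ≡ iter σ a (iter σ b x)
iter-+ σ zero    b x = refl
iter-+ σ (suc a) b x = cong σ (iter-+ σ a b x)

iter-suc : ∀ {m} (σ : Fin m → Fin m) n x → iter σ n (σ x) ≡ iter σ (suc n) x
iter-suc σ n x = trans (sym (iter-+ σ n 1 x)) (cong (λ k → iter σ k x) (+-comm n 1))

iter-injective : ∀ {m} {σ : Fin m → Fin m} → Injective _≡_ _≡_ σ → ∀ n → Injective _≡_ _≡_ (iter σ n)
iter-injective inj zero    e = e
iter-injective inj (suc n) e = iter-injective inj n (inj e)

iter-return : ∀ {m} {σ : Fin m → Fin m} → Injective _≡_ _≡_ σ → ∀ {x} a d →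
              iter σ a x ≡ iter σ (a + d) x → iter σ d x ≡ x
iter-return {σ = σ} inj {x} a d e = sym (iter-injective inj a (trans e (iter-+ σ a d x)))

iter-collision : ∀ {m} {σ : Fin m → Fin m} → Injective _≡_ _≡_ σ → ∀ {x} a b → a < b →
                 iter σ a x ≡ iter σ b x → ∃ λ k → suc a + k ≡ b × iter σ (suc k) x ≡ x
iter-collision {σ = σ} inj {x} a b a<b e with m≤n⇒∃[o]m+o≡n a<b
... | k , refl = k , refl , iter-return inj a (suc k) (trans e (cong (λ n → iter σ n x) (sym (+-suc a k))))

leastWitness : (P : ℕ → Set) → (∀ n → Dec (P n)) → ∀ n →
               (∀ t → t < n → ¬ P t) ⊎ (∃ λ k → P k × (∀ t → t < k → ¬ P t))
leastWitness P P? zero = inj₁ (λ t ())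
leastWitness P P? (suc n) with leastWitness P P? n
... | inj₂ least = inj₂ least
... | inj₁ none with P? n
...   | yes p  = inj₂ (n , p , none)
...   | no ¬p  = inj₁ below
  where
  below : ∀ t → t < suc n → ¬ P t
  below t t<sn with m≤n⇒m<n∨m≡n (≤-pred t<sn)
  ... | inj₁ t<n  = none t t<n
  ... | inj₂ refl = ¬p

record Period {m} (σ : Fin m → Fin m) (x : Fin m) : Set where
  field
    pred-length : ℕ
    closes      : iter σ (suc pred-length) x ≡ x
    minimal     : ∀ t → t < pred-length → iter σ (suc t) x ≢ x

period : ∀ {m} (σ : Fin m → Fin m) → Injective _≡_ _≡_ σ → ∀ x → Period σ x
period {m} σ inj x with FP.pigeonhole (≤-refl {suc m}) (λ (i : Fin (suc m)) → iter σ (toℕ i) x)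
... | i , j , i<j , e with iter-collision inj (toℕ i) (toℕ j) i<j e
...   | t₀ , _ , returns with leastWitness (λ t → iter σ (suc t) x ≡ x) (λ t → iter σ (suc t) x F.≟ x) (suc t₀)
...     | inj₁ none = ⊥-elim (none t₀ ≤-refl returns)
...     | inj₂ (t , closes , minimal) = record { pred-length = t ; closes = closes ; minimal = minimal }

orbit : ∀ {m} → (Fin m → Fin m) → Fin m → ℕ → List (Fin m)
orbit σ x zero    = []
orbit σ x (suc n) = x ∷ orbit σ (σ x) n

length-orbit : ∀ {m} (σ : Fin m → Fin m) x n → length (orbit σ x n) ≡ n
length-orbit σ x zero    = refl
length-orbit σ x (suc n) = cong suc (length-orbit σ (σ x) n)

∈-orbit⁻ : ∀ {m} (σ : Fin m → Fin m) x n {v} → v ∈ orbit σ x n → ∃ λ a → a < n × v ≡ iter σ a x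
∈-orbit⁻ σ x (suc n) (here refl) = 0 , s≤s z≤n , refl
∈-orbit⁻ σ x (suc n) (there p) with ∈-orbit⁻ σ (σ x) n p
... | a , a<n , e = suc a , s≤s a<n , trans e (iter-suc σ a x)

∈-orbit⁺ : ∀ {m} (σ : Fin m → Fin m) x n a → a < n → iter σ a x ∈ orbit σ x n
∈-orbit⁺ σ x (suc n) zero    _         = here refl
∈-orbit⁺ σ x (suc n) (suc a) (s≤s a<n) =
  there (subst (_∈ orbit σ (σ x) n) (iter-suc σ a x) (∈-orbit⁺ σ (σ x) n a a<n))

orbit-unique : ∀ {m} (σ : Fin m → Fin m) y n → (∀ a b → a < b → b < n → iter σ a y ≢ iter σ b y) →
               Unique (orbit σ y n)
orbit-unique σ y zero    distinct = []
orbit-unique σ y (suc n) distinct = All.tabulate head ∷ orbit-unique σ (σ y) n tail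
  where
  head : ∀ {v} → v ∈ orbit σ (σ y) n → y ≢ v
  head p with ∈-orbit⁻ σ (σ y) n p
  ... | b , b<n , refl = λ e → distinct 0 (suc b) (s≤s z≤n) (s≤s b<n) (trans e (iter-suc σ b y))
  tail : ∀ a b → a < b → b < n → iter σ a (σ y) ≢ iter σ b (σ y)
  tail a b a<b b<n e =
    distinct (suc a) (suc b) (s≤s a<b) (s≤s b<n) (trans (sym (iter-suc σ a y)) (trans e (iter-suc σ b y)))

arcsGo-orbit : ∀ {m} (σ : Fin m → Fin m) first y n → iter σ (suc n) y ≡ first →
               arcsGo first (orbit σ y (suc n)) ≡ map (λ v → v , σ v) (orbit σ y (suc n))
arcsGo-orbit σ first y zero    e = cong (λ z → (y , z) ∷ []) (sym e)
arcsGo-orbit σ first y (suc n) e = cong ((y , σ y) ∷_) (arcsGo-orbit σ first (σ y) n (trans (iter-suc σ (suc n) y) e))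

module OrbitCycle {m} (σ : Fin m → Fin m) (inj : Injective _≡_ _≡_ σ) (x : Fin m) (σx≢x : σ x ≢ x)
                  (per : Period σ x) where
  open Period per renaming (pred-length to t)

  c : List (Fin m)
  c = orbit σ x (suc t)

  distinct : ∀ a b → a < b → b < suc t → iter σ a x ≢ iter σ b x
  distinct a b a<b b≤t e with iter-collision inj a b a<b e
  ... | k , refl , returns = minimal k k<t returns
    where
    k<t : k < t
    k<t = ≤-trans (s≤s (m≤n+m k a)) (≤-pred b≤t)

  unique : Unique c
  unique = orbit-unique σ x (suc t) distinct

  1≤t : 1 ≤ t
  1≤t with t in et
  ... | zero  = ⊥-elim (σx≢x (subst (λ z → iter σ (suc z) x ≡ x) et closes))
  ... | suc _ = s≤s z≤n

  2≤length : 2 ≤ length c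
  2≤length rewrite length-orbit σ x (suc t) = s≤s 1≤t

  arcs : cycleArcs c ≡ map (λ v → v , σ v) c
  arcs = arcsGo-orbit σ x x t closes

  preimage : ∀ {v} → σ v ∈ c → v ∈ c
  preimage {v} p with ∈-orbit⁻ σ x (suc t) p
  ... | zero  , _     , e = subst (_∈ c) (sym (inj (trans e (sym closes)))) (∈-orbit⁺ σ x (suc t) t ≤-refl)
  ... | suc a , sa<k , e = subst (_∈ c) (sym (inj e)) (∈-orbit⁺ σ x (suc t) a (≤-trans (n≤1+n (suc a)) sa<k))

  moves : ∀ {v} → v ∈ c → σ v ≢ v
  moves p e with ∈-orbit⁻ σ x (suc t) p
  ... | a , _ , refl = σx≢x (iter-injective inj a (trans (iter-suc σ a x) e))

-- Permutations versus families of disjoint cycles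

moved : ∀ {m} → (Fin m → Fin m) → Fin m → Bool
moved σ j = not ⌊ σ j F.≟ j ⌋

arcsOf : ∀ {m} → List (List (Fin m)) → List (Fin m × Fin m)
arcsOf cs = concatMap cycleArcs cs

LoopFree : ∀ {m} → (Fin m × Fin m → Bool) → Set
LoopFree p = ∀ j → p (j , j) ≡ false

-- The arcs (j , σ j) with σ j ≢ j and the arcs of cs agree as multisets, tested by every loop-free predicate.
CountsAlike : ∀ {m} → (Fin m → Fin m) → List (List (Fin m)) → Set
CountsAlike σ cs = ∀ p → LoopFree p → countFin (λ j → p (j , σ j)) ≡ countList p (arcsOf cs)

CountsAlike-∷ : ∀ {m} {σ τ next : Fin m → Fin m} c cs → Unique c → cycleArcs c ≡ map (λ v → v , next v) c →
                (∀ j → σ j ≡ (if memB F._≟_ j c then next j else τ j)) → (∀ {j} → j ∈ c → τ j ≡ j) →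
                CountsAlike τ cs → CountsAlike σ (c ∷ cs)
CountsAlike-∷ {σ = σ} {τ} {next} c cs unique arcs σ-split τ-fixes-c rest p loopFree = begin
  countFin (λ j → p (j , σ j))
    ≡⟨ countFin-split _ _ _ pointwise ⟩
  countFin (λ j → memB F._≟_ j c ∧ p (j , next j)) + countFin (λ j → p (j , τ j))
    ≡⟨ cong₂ _+_ (countFin-memB c (λ v → p (v , next v)) unique) (rest p loopFree) ⟩
  countList (λ v → p (v , next v)) c + countList p (arcsOf cs)
    ≡⟨ cong (_+ countList p (arcsOf cs)) (sym (trans (cong (countList p) arcs) (countList-map p (λ v → v , next v) c))) ⟩
  countList p (cycleArcs c) + countList p (arcsOf cs)
    ≡⟨ sym (countList-++ p (cycleArcs c) (arcsOf cs)) ⟩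
  countList p (arcsOf (c ∷ cs)) ∎
  where
  open ≡-Reasoning
  pointwise : ∀ j → indicator (p (j , σ j)) ≡ indicator (memB F._≟_ j c ∧ p (j , next j)) + indicator (p (j , τ j))
  pointwise j rewrite σ-split j with memB F._≟_ j c in e
  ... | true rewrite τ-fixes-c (memB-true⇒∈ F._≟_ j c e) | loopFree j = sym (+-identityʳ _)
  ... | false = refl

successor : ∀ {m} → Fin m → List (Fin m) → Fin m → Fin m
successor first []           j = j
successor first (y ∷ [])     j = first
successor first (y ∷ z ∷ zs) j = if ⌊ j F.≟ y ⌋ then z else successor first (z ∷ zs) j

arcsGo-successor : ∀ {m} (first : Fin m) L → Unique L → arcsGo first L ≡ map (λ v → v , successor first L v) L
arcsGo-successor first []           u = refl
arcsGo-successor first (y ∷ [])     u = refl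
arcsGo-successor first (y ∷ z ∷ zs) (y∉ ∷ u) rewrite ⌊≟⌋-true F._≟_ {y} refl =
  cong ((y , z) ∷_) (trans (arcsGo-successor first (z ∷ zs) u)
                           (map-cong-local (All.map (λ ne → cong (_ ,_) (sym (skip ne))) y∉)))
  where
  skip : ∀ {v} → y ≢ v → (if ⌊ v F.≟ y ⌋ then z else successor first (z ∷ zs) v) ≡ successor first (z ∷ zs) v
  skip ne rewrite ⌊≟⌋-false F._≟_ (ne ∘ sym) = refl

map-proj₂-arcsGo : ∀ {A : Set} (first y : A) ys → map proj₂ (arcsGo first (y ∷ ys)) ≡ ys ++ first ∷ []
map-proj₂-arcsGo first y []       = refl
map-proj₂-arcsGo first y (z ∷ zs) = cong (z ∷_) (map-proj₂-arcsGo first z zs)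

map-unique⇒injectiveOn : ∀ {A B : Set} (g : A → B) xs → Unique (map g xs) →
                         ∀ {a b} → a ∈ xs → b ∈ xs → g a ≡ g b → a ≡ b
map-unique⇒injectiveOn g (x ∷ xs) u        (here refl) (here refl) e = refl
map-unique⇒injectiveOn g (x ∷ xs) (gx∉ ∷ u) (here refl) (there q)   e = ⊥-elim (All.lookup gx∉ (∈-map⁺ g q) e)
map-unique⇒injectiveOn g (x ∷ xs) (gx∉ ∷ u) (there p)   (here refl) e = ⊥-elim (All.lookup gx∉ (∈-map⁺ g p) (sym e))
map-unique⇒injectiveOn g (x ∷ xs) (_ ∷ u)   (there p)   (there q)   e = map-unique⇒injectiveOn g xs u p q e

module CycleSuccessor {m} (x : Fin m) (xs : List (Fin m)) (unique : Unique (x ∷ xs)) where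
  c : List (Fin m)
  c = x ∷ xs

  next : Fin m → Fin m
  next = successor x c

  arcs : cycleArcs c ≡ map (λ v → v , next v) c
  arcs = arcsGo-successor x c unique

  map-next : map next c ≡ xs ++ x ∷ []
  map-next = trans (map-∘ c) (trans (cong (map proj₂) (sym arcs)) (map-proj₂-arcsGo x x xs))

  next-∈ : ∀ {v} → v ∈ c → next v ∈ c
  next-∈ {v} p with ∈-++⁻ xs (subst (next v ∈_) map-next (∈-map⁺ next p))
  ... | inj₁ q         = there q
  ... | inj₂ (here e)  = here e

  next-injective : ∀ {a b} → a ∈ c → b ∈ c → next a ≡ next b → a ≡ b
  next-injective = map-unique⇒injectiveOn next c (subst Unique (sym map-next) rotated-unique)
    where
    rotated-unique : Unique (xs ++ x ∷ [])
    rotated-unique =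
      Unique.++⁺ (AllPairs.tail unique) ([] ∷ []) λ { (p , here refl) → Unique[x∷xs]⇒x∉xs unique p }

module _ {m : ℕ} (Arc : Fin m → Fin m → Set) where

  MovesAlong : (Fin m → Fin m) → Set
  MovesAlong σ = ∀ j → σ j ≢ j → Arc j (σ j)

  record CycleFamilyOf (σ : Fin m → Fin m) : Set where
    field
      cycles   : List (List (Fin m))
      family   : IsCycleFamily Arc cycles
      counts   : CountsAlike σ cycles
      support  : All (All (λ v → σ v ≢ v)) cycles

  record PermutationOf (cs : List (List (Fin m))) : Set where
    field
      σ         : Fin m → Fin m
      injective : Injective _≡_ _≡_ σ
      along     : MovesAlong σ
      fixed     : ∀ j → j ∉ concat cs → σ j ≡ j
      closed    : ∀ j → j ∈ concat cs → σ j ∈ concat cs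
      counts    : CountsAlike σ cs

  module RemoveOrbit (σ : Fin m → Fin m) (inj : Injective _≡_ _≡_ σ) (along : MovesAlong σ)
                     (x : Fin m) (σx≢x : σ x ≢ x) (per : Period σ x) where
    open OrbitCycle σ inj x σx≢x per public

    inC : Fin m → Bool
    inC j = memB F._≟_ j c

    σ′ : Fin m → Fin m
    σ′ j = if inC j then j else σ j

    σ′-injective : Injective _≡_ _≡_ σ′
    σ′-injective {a} {b} e with inC a in ea | inC b in eb
    ... | true  | true  = e
    ... | true  | false = ⊥-elim (memB-false⇒∉ F._≟_ b c eb (preimage (subst (_∈ c) e (memB-true⇒∈ F._≟_ a c ea))))
    ... | false | true  = ⊥-elim (memB-false⇒∉ F._≟_ a c ea (preimage (subst (_∈ c) (sym e) (memB-true⇒∈ F._≟_ b c eb))))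
    ... | false | false = inj e

    σ′-along : MovesAlong σ′
    σ′-along j ne with inC j
    ... | true  = ⊥-elim (ne refl)
    ... | false = along j ne

    σ′-fixes-c : ∀ {v} → v ∈ c → σ′ v ≡ v
    σ′-fixes-c {v} p rewrite ∈⇒memB-true F._≟_ v c p = refl

    σ′-moved⇒σ-moved : ∀ {v} → σ′ v ≢ v → σ v ≢ v
    σ′-moved⇒σ-moved {v} ne with inC v
    ... | true  = ⊥-elim (ne refl)
    ... | false = ne

    fewer-moved : countFin (moved σ′) < countFin (moved σ)
    fewer-moved = countFin-< (moved σ′) (moved σ) mono x σ′x σx
      where
      mono : ∀ j → moved σ′ j ≡ true → moved σ j ≡ true
      mono j h with inC j
      ... | true rewrite ⌊≟⌋-true F._≟_ {j} refl with () ← h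
      ... | false = h
      σ′x : moved σ′ x ≡ false
      σ′x rewrite ∈⇒memB-true F._≟_ x c (here refl) = cong not (⌊≟⌋-true F._≟_ {x} refl)
      σx : moved σ x ≡ true
      σx = cong not (⌊≟⌋-false F._≟_ σx≢x)

    c-cycle : IsDirCycle Arc c
    c-cycle = 2≤length , unique ,
      subst (All (λ uv → Arc (proj₁ uv) (proj₂ uv))) (sym arcs) (All.map⁺ (All.tabulate (λ p → along _ (moves p))))

    σ-on-c : ∀ j → σ j ≡ (if inC j then σ j else σ′ j)
    σ-on-c j with inC j
    ... | true  = refl
    ... | false = refl

  -- Induction on the number of points moved by σ: split off the cycle of one of them.
  permutation⇒cycleFamily′ : ∀ n σ → Injective _≡_ _≡_ σ → MovesAlong σ → countFin (moved σ) ≤ n → CycleFamilyOf σ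
  permutation⇒cycleFamily′ n σ inj along bound with FP.any? (λ j → ¬? (σ j F.≟ j))
  ... | no none = record
    { cycles = [] ; family = [] , [] ; counts = λ p loopFree → countFin≡0 _ (noArc p loopFree) ; support = [] }
    where
    noArc : ∀ p → LoopFree p → ∀ j → p (j , σ j) ≡ false
    noArc p loopFree j with σ j F.≟ j
    ... | yes e rewrite e = loopFree j
    ... | no ne = ⊥-elim (none (j , ne))
  ... | yes (x , σx≢x) with n
  ...   | zero   = ⊥-elim (n≮0 (≤-trans fewer-moved bound))
    where open RemoveOrbit σ inj along x σx≢x (period σ inj x)
  ...   | suc n′ = record
    { cycles  = c ∷ cycles
    ; family  = (c-cycle ∷ proj₁ family) , (disjoint ∷ proj₂ family)
    ; counts  = CountsAlike-∷ c cycles unique arcs σ-on-c σ′-fixes-c counts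
    ; support = All.tabulate moves ∷ All.map (All.map σ′-moved⇒σ-moved) support
    }
    where
    open RemoveOrbit σ inj along x σx≢x (period σ inj x)
    open CycleFamilyOf (permutation⇒cycleFamily′ n′ σ′ σ′-injective σ′-along (≤-pred (≤-trans fewer-moved bound)))
    disjoint : All (VertexDisjoint c) cycles
    disjoint = All.map (λ supp v p q → All.lookup supp q (σ′-fixes-c p)) support

  permutation⇒cycleFamily : ∀ σ → Injective _≡_ _≡_ σ → MovesAlong σ → CycleFamilyOf σ
  permutation⇒cycleFamily σ inj along = permutation⇒cycleFamily′ _ σ inj along ≤-refl

  cycleFamily⇒permutation : ∀ cs → IsCycleFamily Arc cs → PermutationOf cs
  cycleFamily⇒permutation [] _ = record
    { σ = λ j → j ; injective = λ e → e ; along = λ j ne → ⊥-elim (ne refl)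
    ; fixed = λ _ _ → refl ; closed = λ _ p → p ; counts = λ p loopFree → countFin≡0 _ loopFree }
  cycleFamily⇒permutation ((x ∷ xs) ∷ cs) (((_ , unique , c-arcs) ∷ cycles) , (c-disjoint ∷ disjoint)) = record
    { σ = σ ; injective = σ-injective ; along = σ-along ; fixed = σ-fixed ; closed = σ-closed ; counts = σ-counts }
    where
    open CycleSuccessor x xs unique
    module R = PermutationOf (cycleFamily⇒permutation cs (cycles , disjoint))

    inC : Fin m → Bool
    inC j = memB F._≟_ j c

    σ : Fin m → Fin m
    σ j = if inC j then next j else R.σ j

    c∉rest : ∀ {v} → v ∈ c → v ∉ concat cs
    c∉rest {v} p q with ∈-concat⁻′ cs q
    ... | c′ , q′ , c′∈ = All.lookup c-disjoint c′∈ v p q′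

    next≢R : ∀ {a b} → a ∈ c → b ∉ c → next a ≢ R.σ b
    next≢R {a} {b} p b∉ e with memB F._≟_ b (concat cs) in eb
    ... | true  = c∉rest (next-∈ p) (subst (_∈ concat cs) (sym e) (R.closed b (memB-true⇒∈ F._≟_ b (concat cs) eb)))
    ... | false = b∉ (subst (_∈ c) (trans e (R.fixed b (memB-false⇒∉ F._≟_ b (concat cs) eb))) (next-∈ p))

    σ-injective : Injective _≡_ _≡_ σ
    σ-injective {a} {b} e with inC a in ea | inC b in eb
    ... | true  | true  = next-injective (memB-true⇒∈ F._≟_ a c ea) (memB-true⇒∈ F._≟_ b c eb) e
    ... | true  | false = ⊥-elim (next≢R (memB-true⇒∈ F._≟_ a c ea) (memB-false⇒∉ F._≟_ b c eb) e)
    ... | false | true  = ⊥-elim (next≢R (memB-true⇒∈ F._≟_ b c eb) (memB-false⇒∉ F._≟_ a c ea) (sym e))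
    ... | false | false = R.injective e

    σ-along : MovesAlong σ
    σ-along j ne with inC j in ej
    ... | true  = All.lookup (All.map⁻ (subst (All (λ uv → Arc (proj₁ uv) (proj₂ uv))) arcs c-arcs))
                             (memB-true⇒∈ F._≟_ j c ej)
    ... | false = R.along j ne

    σ-fixed : ∀ j → j ∉ c ++ concat cs → σ j ≡ j
    σ-fixed j j∉ rewrite ∉⇒memB-false F._≟_ j c (j∉ ∘ ∈-++⁺ˡ) = R.fixed j (j∉ ∘ ∈-++⁺ʳ c)

    σ-closed : ∀ j → j ∈ c ++ concat cs → σ j ∈ c ++ concat cs
    σ-closed j p with inC j in ej
    ... | true = ∈-++⁺ˡ (next-∈ (memB-true⇒∈ F._≟_ j c ej))
    ... | false with ∈-++⁻ c p
    ...   | inj₁ q = ⊥-elim (memB-false⇒∉ F._≟_ j c ej q)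
    ...   | inj₂ q = ∈-++⁺ʳ c (R.closed j q)

    σ-counts : CountsAlike σ (c ∷ cs)
    σ-counts = CountsAlike-∷ c cs unique arcs (λ _ → refl) (λ p → R.fixed _ (c∉rest p)) R.counts

-- Perfect matchings of G versus cycle families of D(G,M)

crosses : ∀ {m} → (Fin m → Bool) → Fin m × Fin m → Bool
crosses Y (u , v) = Y u xor Y v

crosses-loopFree : ∀ {m} (Y : Fin m → Bool) → LoopFree (crosses Y)
crosses-loopFree Y j = xor-same (Y j)

not-xor-not : ∀ a b → not a xor not b ≡ a xor b
not-xor-not true  true  = refl
not-xor-not true  false = refl
not-xor-not false true  = refl
not-xor-not false false = refl

module _ {m : ℕ} (E : Fin m → Fin m → Bool) where

  MpAtMost-cong : ∀ {X X′ : VG m → Bool} {k} → (∀ v → X v ≡ X′ v) → MpAtMost E X k → MpAtMost E X′ k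
  MpAtMost-cong {X} {X′} X≗X′ mp π pm =
    subst (_≤ _) (countFin-cong (λ i → cong₂ _xor_ (X≗X′ (inj₁ i)) (X≗X′ (inj₂ (π i))))) (mp π pm)

module _ {m : ℕ} (Arc : Fin m → Fin m → Set) where

  PorosityAtMost-cong : ∀ {Y Y′ : Fin m → Bool} {k} → (∀ j → Y j ≡ Y′ j) →
                        PorosityAtMost Arc Y k → PorosityAtMost Arc Y′ k
  PorosityAtMost-cong Y≗Y′ por cs fam =
    subst (_≤ _) (countList-cong (arcsOf cs) (λ (u , v) → cong₂ _xor_ (Y≗Y′ u) (Y≗Y′ v))) (por cs fam)

  PorosityAtMost-complement : ∀ (Y : Fin m → Bool) {k} → PorosityAtMost Arc Y k → PorosityAtMost Arc (not ∘ Y) k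
  PorosityAtMost-complement Y por cs fam =
    subst (_≤ _) (countList-cong (arcsOf cs) (λ (u , v) → sym (not-xor-not (Y u) (Y v)))) (por cs fam)

UnionOfMEdges : ∀ {m} → (Fin m → Fin m) → (VG m → Bool) → Set
UnionOfMEdges μ X = ∀ i → X (inj₁ i) ≡ X (inj₂ (μ i))

conformal⇒unionOfMEdges : ∀ {m} {μ : Fin m → Fin m} (X : VG m → Bool) → Conformal μ X → UnionOfMEdges μ X
conformal⇒unionOfMEdges {μ = μ} X ((a⇒b , b⇒a) , _) i with X (inj₁ i) in ea | X (inj₂ (μ i)) in eb
... | true  | true  = refl
... | true  | false = trans (sym (a⇒b i ea)) eb
... | false | true  = trans (sym ea) (b⇒a i eb)
... | false | false = refl

unionOfMEdges⇒conformal : ∀ {m} {μ : Fin m → Fin m} (X : VG m → Bool) → UnionOfMEdges μ X → Conformal μ X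
unionOfMEdges⇒conformal X u =
  ((λ i e → trans (sym (u i)) e) , (λ i e → trans (u i) e)) ,
  ((λ i e → trans (cong not (sym (u i))) e) , (λ i e → trans (cong not (u i)) e))

module MatchingCycles {m : ℕ} (E : Fin m → Fin m → Bool) (μ : Fin m → Fin m) (μ-pm : IsPM E μ) where
  D : Fin m → Fin m → Set
  D = MDirArc E μ

  μ⁻¹ : Fin m → Fin m
  μ⁻¹ j = proj₁ (injective⇒surjective μ (proj₁ μ-pm) j)

  μ-μ⁻¹ : ∀ j → μ (μ⁻¹ j) ≡ j
  μ-μ⁻¹ j = proj₂ (injective⇒surjective μ (proj₁ μ-pm) j)

  μ⁻¹-μ : ∀ i → μ⁻¹ (μ i) ≡ i
  μ⁻¹-μ i = proj₁ μ-pm (μ-μ⁻¹ (μ i))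

  μ⁻¹-injective : Injective _≡_ _≡_ μ⁻¹
  μ⁻¹-injective {a} {b} e = trans (sym (μ-μ⁻¹ a)) (trans (cong μ e) (μ-μ⁻¹ b))

  -- The cycle family of σ gives the perfect matching {a_j b_(μ (σ j))} crossing X as often.
  mp⇒porosity : ∀ (X : VG m → Bool) k → UnionOfMEdges μ X → MpAtMost E X k →
                PorosityAtMost D (X ∘ inj₁) k
  mp⇒porosity X k union mp cs fam = subst (_≤ k) same-cut (mp π π-pm)
    where
    open PermutationOf (cycleFamily⇒permutation D cs fam)
    π : Fin m → Fin m
    π = μ ∘ σ
    π-pm : IsPM E π
    π-pm = (λ e → injective (proj₁ μ-pm e)) , edge
      where
      edge : ∀ i → E i (π i) ≡ true
      edge i with σ i F.≟ i
      ... | yes e = subst (λ z → E i (μ z) ≡ true) (sym e) (proj₂ μ-pm i)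
      ... | no ne = proj₂ (along i ne)
    same-cut : cutPM X π ≡ cutFamily (X ∘ inj₁) cs
    same-cut = trans (countFin-cong (λ i → cong (X (inj₁ i) xor_) (sym (union (σ i)))))
                     (counts (crosses (X ∘ inj₁)) (crosses-loopFree (X ∘ inj₁)))

  expand : (Fin m → Bool) → VG m → Bool
  expand Y (inj₁ i) = Y i
  expand Y (inj₂ j) = Y (μ⁻¹ j)

  expand-unionOfMEdges : ∀ Y → UnionOfMEdges μ (expand Y)
  expand-unionOfMEdges Y i = cong Y (sym (μ⁻¹-μ i))

  -- A perfect matching {a_j b_(π j)} gives the permutation μ⁻¹ ∘ π, whose cycles cross Y as often.
  porosity⇒mp : ∀ (Y : Fin m → Bool) k → PorosityAtMost D Y k → MpAtMost E (expand Y) k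
  porosity⇒mp Y k por π (π-injective , π-edge) =
    subst (_≤ k) (sym (counts (crosses Y) (crosses-loopFree Y))) (por cycles family)
    where
    σ : Fin m → Fin m
    σ = μ⁻¹ ∘ π
    σ-along : MovesAlong D σ
    σ-along j ne = (ne ∘ sym) , subst (λ z → E j z ≡ true) (sym (μ-μ⁻¹ (π j))) (π-edge j)
    open CycleFamilyOf (permutation⇒cycleFamily D σ (π-injective ∘ μ⁻¹-injective) σ-along)

unique-++ˡ : ∀ {A : Set} (xs ys : List A) → Unique (xs ++ ys) → Unique xs
unique-++ˡ []       ys u        = []
unique-++ˡ (x ∷ xs) ys (x∉ ∷ u) = All.++⁻ˡ xs x∉ ∷ unique-++ˡ xs ys u

unique-++ʳ : ∀ {A : Set} (xs ys : List A) → Unique (xs ++ ys) → Unique ys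
unique-++ʳ []       ys u       = u
unique-++ʳ (x ∷ xs) ys (_ ∷ u) = unique-++ʳ xs ys u

unique-++-disjoint : ∀ {A : Set} (xs ys : List A) → Unique (xs ++ ys) → ∀ {w} → w ∈ xs → w ∈ ys → ⊥
unique-++-disjoint (x ∷ xs) ys (x∉ ∷ u) (here refl) q = All.lookup x∉ (∈-++⁺ʳ xs q) refl
unique-++-disjoint (x ∷ xs) ys (_ ∷ u)  (there p)   q = unique-++-disjoint xs ys u p q

module _ {V : Set} where

  subtrees-self : ∀ (t : BTree V) → t ∈ subtrees t
  subtrees-self (leaf v)   = here refl
  subtrees-self (node l r) = here refl

  subtrees-trans : ∀ {x y z : BTree V} → x ∈ subtrees y → y ∈ subtrees z → x ∈ subtrees z
  subtrees-trans {z = leaf v}   p (here refl) = p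
  subtrees-trans {z = node l r} p (here refl) = p
  subtrees-trans {z = node l r} p (there q) with ∈-++⁻ (subtrees l) q
  ... | inj₁ q′ = there (∈-++⁺ˡ (subtrees-trans p q′))
  ... | inj₂ q′ = there (∈-++⁺ʳ (subtrees l) (subtrees-trans p q′))

  nodeSubtrees-trans : ∀ {x y z : BTree V} → x ∈ nodeSubtrees y → y ∈ nodeSubtrees z → x ∈ nodeSubtrees z
  nodeSubtrees-trans {z = node l r} p (here refl) = p
  nodeSubtrees-trans {z = node l r} p (there q) with ∈-++⁻ (nodeSubtrees l) q
  ... | inj₁ q′ = there (∈-++⁺ˡ (nodeSubtrees-trans p q′))
  ... | inj₂ q′ = there (∈-++⁺ʳ (nodeSubtrees l) (nodeSubtrees-trans p q′))

  nodeSubtrees⊆subtrees : ∀ {x t : BTree V} → x ∈ nodeSubtrees t → x ∈ subtrees t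
  nodeSubtrees⊆subtrees {t = node l r} (here refl) = here refl
  nodeSubtrees⊆subtrees {t = node l r} (there q) with ∈-++⁻ (nodeSubtrees l) q
  ... | inj₁ q′ = there (∈-++⁺ˡ (nodeSubtrees⊆subtrees q′))
  ... | inj₂ q′ = there (∈-++⁺ʳ (subtrees l) (nodeSubtrees⊆subtrees q′))

  innerSubtrees⊆nodeSubtrees : ∀ {x : BTree V} t → x ∈ innerSubtrees t → x ∈ nodeSubtrees t
  innerSubtrees⊆nodeSubtrees (node l r) q = there q

  innerSubtrees⊆subtrees : ∀ {x : BTree V} t → x ∈ innerSubtrees t → x ∈ subtrees t
  innerSubtrees⊆subtrees t = nodeSubtrees⊆subtrees ∘ innerSubtrees⊆nodeSubtrees t

  nodeSubtrees-top-or-inner : ∀ {x : BTree V} t → x ∈ nodeSubtrees t → x ≡ t ⊎ x ∈ innerSubtrees t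
  nodeSubtrees-top-or-inner (node l r) (here refl) = inj₁ refl
  nodeSubtrees-top-or-inner (node l r) (there q)   = inj₂ q

  nodeSubtrees-innerSubtrees-trans : ∀ {x p : BTree V} t → x ∈ nodeSubtrees p → p ∈ innerSubtrees t → x ∈ innerSubtrees t
  nodeSubtrees-innerSubtrees-trans (node l r) xp q with ∈-++⁻ (nodeSubtrees l) q
  ... | inj₁ q′ = ∈-++⁺ˡ (nodeSubtrees-trans xp q′)
  ... | inj₂ q′ = ∈-++⁺ʳ (nodeSubtrees l) (nodeSubtrees-trans xp q′)

  subtree-node-or-leaf : ∀ {s t : BTree V} → s ∈ subtrees t → s ∈ nodeSubtrees t ⊎ ∃ (λ v → s ≡ leaf v)
  subtree-node-or-leaf {t = leaf v}   (here refl) = inj₂ (v , refl)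
  subtree-node-or-leaf {t = node l r} (here refl) = inj₁ (here refl)
  subtree-node-or-leaf {t = node l r} (there q) with ∈-++⁻ (subtrees l) q
  ... | inj₁ q′ with subtree-node-or-leaf q′
  ...   | inj₁ n  = inj₁ (there (∈-++⁺ˡ n))
  ...   | inj₂ lf = inj₂ lf
  subtree-node-or-leaf {t = node l r} (there q) | inj₂ q′ with subtree-node-or-leaf q′
  ...   | inj₁ n  = inj₁ (there (∈-++⁺ʳ (nodeSubtrees l) n))
  ...   | inj₂ lf = inj₂ lf

  leaves-subtree : ∀ {s t : BTree V} {w} → s ∈ subtrees t → w ∈ leaves s → w ∈ leaves t
  leaves-subtree {t = leaf v}   (here refl) p = p
  leaves-subtree {t = node l r} (here refl) p = p
  leaves-subtree {t = node l r} (there q) p with ∈-++⁻ (subtrees l) q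
  ... | inj₁ q′ = ∈-++⁺ˡ (leaves-subtree q′ p)
  ... | inj₂ q′ = ∈-++⁺ʳ (leaves l) (leaves-subtree q′ p)

  unique-subtree : ∀ {s t : BTree V} → s ∈ subtrees t → Unique (leaves t) → Unique (leaves s)
  unique-subtree {t = leaf v}   (here refl) u = u
  unique-subtree {t = node l r} (here refl) u = u
  unique-subtree {t = node l r} (there q) u with ∈-++⁻ (subtrees l) q
  ... | inj₁ q′ = unique-subtree q′ (unique-++ˡ (leaves l) (leaves r) u)
  ... | inj₂ q′ = unique-subtree q′ (unique-++ʳ (leaves l) (leaves r) u)

module DecompProperties {V : Set} (_≟_ : DecidableEquality V) (d : Decomp V) where
  root∉body : root d ∉ leaves (body d)
  root∉body = Unique[x∷xs]⇒x∉xs (uniq d)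

  unique-body : Unique (leaves (body d))
  unique-body = AllPairs.tail (uniq d)

  ∈-body : ∀ w → w ≢ root d → w ∈ leaves (body d)
  ∈-body w ne with cover d w
  ... | here e = ⊥-elim (ne e)
  ... | there p = p

  shore-body : ∀ w → shore _≟_ (body d) w ≡ not ⌊ root d ≟ w ⌋
  shore-body w with root d ≟ w
  ... | yes refl = ∉⇒memB-false _≟_ (root d) (leaves (body d)) root∉body
  ... | no ne    = ∈⇒memB-true _≟_ w (leaves (body d)) (∈-body w (ne ∘ sym))

-- Expanding a cycle decomposition of D(G,M) into one of G

cutPM≤1 : ∀ {m} (X : VG m → Bool) (b : Bool) w → (∀ v → v ≢ w → X v ≡ b) →
          ∀ π → Injective _≡_ _≡_ π → cutPM X π ≤ 1
cutPM≤1 X b w const π π-injective = countFin≤1 _ same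
  where
  touches : ∀ i → X (inj₁ i) xor X (inj₂ (π i)) ≡ true → inj₁ i ≡ w ⊎ inj₂ (π i) ≡ w
  touches i e with inj₁ i ≟G w | inj₂ (π i) ≟G w
  ... | yes p | _     = inj₁ p
  ... | no _  | yes q = inj₂ q
  ... | no p  | no q rewrite const (inj₁ i) p | const (inj₂ (π i)) q | xor-same b with () ← e
  same : ∀ i j → X (inj₁ i) xor X (inj₂ (π i)) ≡ true → X (inj₁ j) xor X (inj₂ (π j)) ≡ true → i ≡ j
  same i j ei ej with touches i ei | touches j ej
  ... | inj₁ refl | inj₁ refl = refl
  ... | inj₁ refl | inj₂ ()
  ... | inj₂ refl | inj₁ ()
  ... | inj₂ p    | inj₂ q    = π-injective (inj₂-injective (trans p (sym q)))

MpAtMost-leaf : ∀ {m} (E : Fin m → Fin m → Bool) u k → 1 ≤ k → MpAtMost E (shore _≟G_ (leaf u)) k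
MpAtMost-leaf E u k 1≤k π (π-injective , _) =
  ≤-trans (cutPM≤1 _ false u (λ v ne → cong (_∨ false) (⌊≟⌋-false _≟G_ (ne ∘ sym))) π π-injective) 1≤k

module Expansion {m : ℕ} (E : Fin m → Fin m → Bool) (μ : Fin m → Fin m) (μ-pm : IsPM E μ) where
  open MatchingCycles E μ μ-pm

  expandTree : BTree (Fin m) → BTree (VG m)
  expandTree (leaf i)   = node (leaf (inj₁ i)) (leaf (inj₂ (μ i)))
  expandTree (node l r) = node (expandTree l) (expandTree r)

  double : List (Fin m) → List (VG m)
  double []       = []
  double (i ∷ is) = inj₁ i ∷ inj₂ (μ i) ∷ double is

  double-++ : ∀ xs ys → double (xs ++ ys) ≡ double xs ++ double ys
  double-++ []       ys = refl
  double-++ (x ∷ xs) ys = cong (λ z → inj₁ x ∷ inj₂ (μ x) ∷ z) (double-++ xs ys)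

  leaves-expandTree : ∀ s → leaves (expandTree s) ≡ double (leaves s)
  leaves-expandTree (leaf i)   = refl
  leaves-expandTree (node l r) =
    trans (cong₂ _++_ (leaves-expandTree l) (leaves-expandTree r)) (sym (double-++ (leaves l) (leaves r)))

  ∈-double⁻ : ∀ L {v} → v ∈ double L → ∃ λ i → i ∈ L × (v ≡ inj₁ i ⊎ v ≡ inj₂ (μ i))
  ∈-double⁻ (i ∷ is) (here e)         = i , here refl , inj₁ e
  ∈-double⁻ (i ∷ is) (there (here e)) = i , here refl , inj₂ e
  ∈-double⁻ (i ∷ is) (there (there p)) with ∈-double⁻ is p
  ... | j , q , r = j , there q , r

  ∈-double⁺₁ : ∀ L {i} → i ∈ L → inj₁ i ∈ double L
  ∈-double⁺₁ (x ∷ L) (here refl) = here refl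
  ∈-double⁺₁ (x ∷ L) (there p)   = there (there (∈-double⁺₁ L p))

  ∈-double⁺₂ : ∀ L {i} → i ∈ L → inj₂ (μ i) ∈ double L
  ∈-double⁺₂ (x ∷ L) (here refl) = there (here refl)
  ∈-double⁺₂ (x ∷ L) (there p)   = there (there (∈-double⁺₂ L p))

  ∈-double₁ : ∀ L {i} → inj₁ i ∈ double L → i ∈ L
  ∈-double₁ L p with ∈-double⁻ L p
  ... | _ , q , inj₁ refl = q

  ∈-double₂ : ∀ L {i} → inj₂ (μ i) ∈ double L → i ∈ L
  ∈-double₂ L p with ∈-double⁻ L p
  ... | _ , q , inj₂ e = subst (_∈ L) (sym (proj₁ μ-pm (inj₂-injective e))) q

  unique-double : ∀ L → Unique L → Unique (double L)
  unique-double []       u        = []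
  unique-double (i ∷ is) (i∉ ∷ u) =
    ((λ ()) ∷ ¬Any⇒All¬ _ (All¬⇒¬Any i∉ ∘ ∈-double₁ is)) ∷
    (¬Any⇒All¬ _ (All¬⇒¬Any i∉ ∘ ∈-double₂ is) ∷ unique-double is u)

  shore-expandTree : ∀ s v → shore _≟G_ (expandTree s) v ≡ expand (shore F._≟_ s) v
  shore-expandTree s (inj₁ i) = memB-cong _≟G_ F._≟_ (inj₁ i) (leaves (expandTree s)) i (leaves s)
    (λ p → ∈-double₁ (leaves s) (subst (inj₁ i ∈_) (leaves-expandTree s) p))
    (λ q → subst (inj₁ i ∈_) (sym (leaves-expandTree s)) (∈-double⁺₁ (leaves s) q))
  shore-expandTree s (inj₂ j) = memB-cong _≟G_ F._≟_ (inj₂ j) (leaves (expandTree s)) (μ⁻¹ j) (leaves s)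
    (λ p → ∈-double₂ (leaves s) (subst (λ z → inj₂ z ∈ _) (sym (μ-μ⁻¹ j))
                                        (subst (inj₂ j ∈_) (leaves-expandTree s) p)))
    (λ q → subst (inj₂ j ∈_) (sym (leaves-expandTree s))
                 (subst (λ z → inj₂ z ∈ double (leaves s)) (μ-μ⁻¹ j) (∈-double⁺₂ (leaves s) q)))

  -- The root leaf v_r becomes the root leaf a_r next to the leaf b_(μ r).
  expandDecomp : Decomp (Fin m) → Decomp (VG m)
  expandDecomp d = mkDecomp (inj₁ (root d)) (node (leaf (inj₂ (μ (root d)))) (expandTree (body d)))
    (subst Unique labels (unique-double (root d ∷ leaves (body d)) (uniq d)))
    (λ v → subst (v ∈_) labels (covered v))
    where
    labels : double (root d ∷ leaves (body d)) ≡ inj₁ (root d) ∷ inj₂ (μ (root d)) ∷ leaves (expandTree (body d))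
    labels = cong (λ z → inj₁ (root d) ∷ inj₂ (μ (root d)) ∷ z) (sym (leaves-expandTree (body d)))
    covered : ∀ v → v ∈ double (root d ∷ leaves (body d))
    covered (inj₁ i) = ∈-double⁺₁ _ (cover d i)
    covered (inj₂ j) =
      subst (λ z → inj₂ z ∈ double (root d ∷ leaves (body d))) (μ-μ⁻¹ j) (∈-double⁺₂ _ (cover d (μ⁻¹ j)))

  subtrees-expandTree : ∀ {t} s → t ∈ subtrees (expandTree s) →
                        (∃ λ s′ → s′ ∈ subtrees s × t ≡ expandTree s′) ⊎ (∃ λ u → t ≡ leaf u)
  subtrees-expandTree (leaf i)   (here refl)                 = inj₁ (leaf i , here refl , refl)
  subtrees-expandTree (leaf i)   (there (here refl))         = inj₂ (inj₁ i , refl)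
  subtrees-expandTree (leaf i)   (there (there (here refl))) = inj₂ (inj₂ (μ i) , refl)
  subtrees-expandTree (node l r) (here refl)                 = inj₁ (node l r , here refl , refl)
  subtrees-expandTree (node l r) (there q) with ∈-++⁻ (subtrees (expandTree l)) q
  ... | inj₁ q′ with subtrees-expandTree l q′
  ...   | inj₁ (s′ , p , e) = inj₁ (s′ , there (∈-++⁺ˡ p) , e)
  ...   | inj₂ lf           = inj₂ lf
  subtrees-expandTree (node l r) (there q) | inj₂ q′ with subtrees-expandTree r q′
  ...   | inj₁ (s′ , p , e) = inj₁ (s′ , there (∈-++⁺ʳ (subtrees l) p) , e)
  ...   | inj₂ lf           = inj₂ lf

  nodeSubtrees-expandTree : ∀ {t} s → t ∈ nodeSubtrees (expandTree s) → ∃ λ s′ → t ≡ expandTree s′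
  nodeSubtrees-expandTree (leaf i)   (here refl) = leaf i , refl
  nodeSubtrees-expandTree (node l r) (here refl) = node l r , refl
  nodeSubtrees-expandTree (node l r) (there q) with ∈-++⁻ (nodeSubtrees (expandTree l)) q
  ... | inj₁ q′ = nodeSubtrees-expandTree l q′
  ... | inj₂ q′ = nodeSubtrees-expandTree r q′

  expandDecomp-width : ∀ d k → 1 ≤ k → CycWidthAtMost D d k → PMWidthAtMost E (expandDecomp d) k
  expandDecomp-width d k 1≤k cw = body-cut ∷ MpAtMost-leaf E (inj₂ (μ (root d))) k 1≤k ∷ All.tabulate expanded
    where
    open DecompProperties _≟G_ (expandDecomp d)
    body-cut : MpAtMost E (shore _≟G_ (body (expandDecomp d))) k
    body-cut π (π-injective , _) = ≤-trans (cutPM≤1 _ true (inj₁ (root d))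
      (λ v ne → trans (shore-body v) (cong not (⌊≟⌋-false _≟G_ (ne ∘ sym)))) π π-injective) 1≤k
    expanded : ∀ {t} → t ∈ subtrees (expandTree (body d)) → MpAtMost E (shore _≟G_ t) k
    expanded p with subtrees-expandTree (body d) p
    ... | inj₂ (u , refl)       = MpAtMost-leaf E u k 1≤k
    ... | inj₁ (s′ , q , refl) = MpAtMost-cong E (sym ∘ shore-expandTree s′)
                                   (porosity⇒mp (shore F._≟_ s′) k (All.lookup cw q))

  expandDecomp-conformal : ∀ d → MConformalDecomp μ (expandDecomp d)
  expandDecomp-conformal d = All.tabulate conformal
    where
    conformal : ∀ {t} → t ∈ nodeSubtrees (expandTree (body d)) →
                Conformal μ (shore _≟G_ t) × Conformal μ (not ∘ shore _≟G_ t)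
    conformal p with nodeSubtrees-expandTree (body d) p
    ... | s′ , refl = unionOfMEdges⇒conformal (shore _≟G_ (expandTree s′)) union ,
                      unionOfMEdges⇒conformal (not ∘ shore _≟G_ (expandTree s′)) (cong not ∘ union)
      where
      union : UnionOfMEdges μ (shore _≟G_ (expandTree s′))
      union i = trans (shore-expandTree s′ (inj₁ i))
                      (trans (expand-unionOfMEdges (shore F._≟_ s′) i) (sym (shore-expandTree s′ (inj₂ (μ i)))))

another : ∀ {m} → 2 ≤ m → (r : Fin m) → ∃ λ r′ → r′ ≢ r
another {suc (suc n)} _ F.zero    = F.suc F.zero , λ ()
another {suc (suc n)} _ (F.suc r) = F.zero , λ ()
another {suc zero} (s≤s ()) F.zero

module _ {m : ℕ} (E : Fin m → Fin m → Bool) (μ : Fin m → Fin m) where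

  LeavingEdge : Fin m → Set
  LeavingEdge r = (∃ λ j → E r j ≡ true × j ≢ μ r) ⊎ (∃ λ i → E i (μ r) ≡ true × i ≢ r)

  leavingEdge : ∀ r {u w} → Reach E u w → (u ≡ inj₁ r ⊎ u ≡ inj₂ (μ r)) →
                w ≢ inj₁ r → w ≢ inj₂ (μ r) → LeavingEdge r
  leavingEdge r here u-in w≢a w≢b with u-in
  ... | inj₁ e = ⊥-elim (w≢a e)
  ... | inj₂ e = ⊥-elim (w≢b e)
  leavingEdge r (step {v = inj₁ i} adj rest) (inj₂ refl) w≢a w≢b with i F.≟ r
  ... | yes refl = leavingEdge r rest (inj₁ refl) w≢a w≢b
  ... | no i≢r   = inj₂ (i , adj , i≢r)
  leavingEdge r (step {v = inj₂ j} adj rest) (inj₁ refl) w≢a w≢b with j F.≟ μ r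
  ... | yes refl = leavingEdge r rest (inj₂ refl) w≢a w≢b
  ... | no j≢μr  = inj₁ (j , adj , j≢μr)
  leavingEdge r (step {v = inj₁ _} () _) (inj₁ refl) _ _
  leavingEdge r (step {v = inj₂ _} () _) (inj₂ refl) _ _

  perfectMatching-avoiding : 2 ≤ m → MatchingCovered E → IsPM E μ → ∀ r → ∃ λ π → IsPM E π × π r ≢ μ r
  perfectMatching-avoiding 2≤m (connected , covered) μ-pm r with another 2≤m r
  ... | r′ , r′≢r with leavingEdge r (connected (inj₁ r) (inj₁ r′)) (inj₁ refl) (r′≢r ∘ inj₁-injective) (λ ())
  ...   | inj₁ (j , e , j≢μr) with covered r j e
  ...     | π , pm , πr≡j = π , pm , j≢μr ∘ trans (sym πr≡j)
  perfectMatching-avoiding 2≤m (connected , covered) μ-pm r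
      | r′ , r′≢r | inj₂ (i , e , i≢r) with covered i (μ r) e
  ...     | π , pm , πi≡μr = π , pm , λ πr≡μr → i≢r (proj₁ pm (trans πi≡μr (sym πr≡μr)))

  -- A perfect matching avoiding the M-edge at v_r moves v_r, so its cycles cross the cut of the root leaf.
  cycWidth-≥1 : 2 ≤ m → MatchingCovered E → (μ-pm : IsPM E μ) →
                ∀ d k → CycWidthAtMost (MDirArc E μ) d k → 1 ≤ k
  cycWidth-≥1 2≤m mc μ-pm d k cw with perfectMatching-avoiding 2≤m mc μ-pm (root d)
  ... | π , pm , πr≢μr =
    ≤-trans (1≤countFin _ r crossing) (porosity⇒mp Y k (All.lookup cw (subtrees-self (body d))) π pm)
    where
    open MatchingCycles E μ μ-pm
    open DecompProperties F._≟_ d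
    r = root d
    Y = shore F._≟_ (body d)
    r≢σr : r ≢ μ⁻¹ (π r)
    r≢σr e = πr≢μr (trans (sym (μ-μ⁻¹ (π r))) (cong μ (sym e)))
    crossing : Y r xor Y (μ⁻¹ (π r)) ≡ true
    crossing rewrite shore-body r | shore-body (μ⁻¹ (π r)) | ⌊≟⌋-true F._≟_ {r} refl | ⌊≟⌋-false F._≟_ r≢σr = refl

-- Contracting an M-conformal decomposition of G into one of D(G,M)

4≤covering-length : ∀ {m} → 2 ≤ m → (L : List (VG m)) → (∀ v → v ∈ L) → 4 ≤ length L
4≤covering-length {m} 2≤m L covers = ≤-trans (+-mono-≤ 2≤m 2≤m) (FP.injective⇒≤ position-injective)
  where
  position : Fin (m + m) → Fin (length L)
  position = Any.index ∘ covers ∘ F.splitAt m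
  position-injective : Injective _≡_ _≡_ position
  position-injective {a} {b} e = begin
    a                          ≡⟨ sym (FP.join-splitAt m m a) ⟩
    F.join m m (F.splitAt m a) ≡⟨ cong (F.join m m) same-vertex ⟩
    F.join m m (F.splitAt m b) ≡⟨ FP.join-splitAt m m b ⟩
    b                          ∎
    where
    open ≡-Reasoning
    same-vertex : F.splitAt m a ≡ F.splitAt m b
    same-vertex = trans (lookup-index (covers (F.splitAt m a)))
                        (trans (cong (lookup L) e) (sym (lookup-index (covers (F.splitAt m b)))))

module _ {V : Set} where

  data HasLeafChild (v : V) (t : BTree V) : BTree V → Set where
    leftLeaf  : HasLeafChild v t (node (leaf v) t)
    rightLeaf : HasLeafChild v t (node t (leaf v))

  findParent : ∀ (v : V) t → v ∈ leaves t → t ≡ leaf v ⊎ ∃₂ λ p t′ → p ∈ nodeSubtrees t × HasLeafChild v t′ p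
  findParent v (leaf x) (here refl) = inj₁ refl
  findParent v (node l r) q with ∈-++⁻ (leaves l) q
  ... | inj₁ ql with findParent v l ql
  ...   | inj₁ refl                 = inj₂ (_ , r , here refl , leftLeaf)
  ...   | inj₂ (p , t′ , p∈ , child) = inj₂ (p , t′ , there (∈-++⁺ˡ p∈) , child)
  findParent v (node l r) q | inj₂ qr with findParent v r qr
  ...   | inj₁ refl                 = inj₂ (_ , l , here refl , rightLeaf)
  ...   | inj₂ (p , t′ , p∈ , child) = inj₂ (p , t′ , there (∈-++⁺ʳ (nodeSubtrees l) p∈) , child)

  module _ {v : V} {t p : BTree V} where

    leaf∈parent : HasLeafChild v t p → v ∈ leaves p
    leaf∈parent leftLeaf  = here refl
    leaf∈parent rightLeaf = ∈-++⁺ʳ (leaves t) (here refl)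

    ∈-parent⁻ : HasLeafChild v t p → ∀ {w} → w ∈ leaves p → w ≡ v ⊎ w ∈ leaves t
    ∈-parent⁻ leftLeaf (here e)  = inj₁ e
    ∈-parent⁻ leftLeaf (there q) = inj₂ q
    ∈-parent⁻ rightLeaf q with ∈-++⁻ (leaves t) q
    ... | inj₁ q′        = inj₂ q′
    ... | inj₂ (here e)  = inj₁ e

    leaf∉sibling : HasLeafChild v t p → Unique (leaves p) → v ∉ leaves t
    leaf∉sibling leftLeaf  u     = Unique[x∷xs]⇒x∉xs u
    leaf∉sibling rightLeaf u q   = unique-++-disjoint (leaves t) (v ∷ []) u q (here refl)

    sibling-inner : HasLeafChild v t p → ∀ {x} → x ∈ nodeSubtrees t → x ∈ innerSubtrees p
    sibling-inner leftLeaf  = λ q → q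
    sibling-inner rightLeaf = ∈-++⁺ˡ

    length-parent : HasLeafChild v t p → length (leaves p) ≡ suc (length (leaves t))
    length-parent leftLeaf  = refl
    length-parent rightLeaf = trans (length-++ (leaves t)) (+-comm (length (leaves t)) 1)

module _ {m : ℕ} where

  aIndices : List (VG m) → List (Fin m)
  aIndices []             = []
  aIndices (inj₁ i ∷ vs) = i ∷ aIndices vs
  aIndices (inj₂ _ ∷ vs) = aIndices vs

  aIndices-++ : ∀ xs ys → aIndices (xs ++ ys) ≡ aIndices xs ++ aIndices ys
  aIndices-++ []             ys = refl
  aIndices-++ (inj₁ i ∷ xs) ys = cong (i ∷_) (aIndices-++ xs ys)
  aIndices-++ (inj₂ _ ∷ xs) ys = aIndices-++ xs ys

  ∈-aIndices⁺ : ∀ vs {i} → inj₁ i ∈ vs → i ∈ aIndices vs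
  ∈-aIndices⁺ (inj₁ j ∷ vs) (here refl) = here refl
  ∈-aIndices⁺ (inj₁ j ∷ vs) (there p)   = there (∈-aIndices⁺ vs p)
  ∈-aIndices⁺ (inj₂ j ∷ vs) (there p)   = ∈-aIndices⁺ vs p

  ∈-aIndices⁻ : ∀ vs {i} → i ∈ aIndices vs → inj₁ i ∈ vs
  ∈-aIndices⁻ (inj₁ j ∷ vs) (here refl) = here refl
  ∈-aIndices⁻ (inj₁ j ∷ vs) (there p)   = there (∈-aIndices⁻ vs p)
  ∈-aIndices⁻ (inj₂ j ∷ vs) p           = there (∈-aIndices⁻ vs p)

  unique-aIndices : ∀ vs → Unique vs → Unique (aIndices vs)
  unique-aIndices []             u        = []
  unique-aIndices (inj₁ i ∷ vs) (i∉ ∷ u) = ¬Any⇒All¬ _ (All¬⇒¬Any i∉ ∘ ∈-aIndices⁻ vs) ∷ unique-aIndices vs u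
  unique-aIndices (inj₂ j ∷ vs) (_ ∷ u)  = unique-aIndices vs u

  graft : Maybe (BTree (Fin m)) → Maybe (BTree (Fin m)) → Maybe (BTree (Fin m))
  graft (just l) (just r) = just (node l r)
  graft (just l) nothing  = just l
  graft nothing  y        = y

  -- Delete the leaves b_j and suppress the resulting vertices of degree two.
  contract : BTree (VG m) → Maybe (BTree (Fin m))
  contract (leaf (inj₁ i)) = just (leaf i)
  contract (leaf (inj₂ _)) = nothing
  contract (node l r)      = graft (contract l) (contract r)

  maybeLeaves : Maybe (BTree (Fin m)) → List (Fin m)
  maybeLeaves nothing  = []
  maybeLeaves (just t) = leaves t

  maybeSubtrees : Maybe (BTree (Fin m)) → List (BTree (Fin m))
  maybeSubtrees nothing  = []
  maybeSubtrees (just t) = subtrees t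

  maybeLeaves-graft : ∀ x y → maybeLeaves (graft x y) ≡ maybeLeaves x ++ maybeLeaves y
  maybeLeaves-graft (just l) (just r) = refl
  maybeLeaves-graft (just l) nothing  = sym (++-identityʳ (leaves l))
  maybeLeaves-graft nothing  y        = refl

  leaves-contract : ∀ s → maybeLeaves (contract s) ≡ aIndices (leaves s)
  leaves-contract (leaf (inj₁ i)) = refl
  leaves-contract (leaf (inj₂ _)) = refl
  leaves-contract (node l r) = trans (maybeLeaves-graft (contract l) (contract r))
    (trans (cong₂ _++_ (leaves-contract l) (leaves-contract r)) (sym (aIndices-++ (leaves l) (leaves r))))

  leaves-contract-just : ∀ s {t} → contract s ≡ just t → leaves t ≡ aIndices (leaves s)
  leaves-contract-just s e = trans (cong maybeLeaves (sym e)) (leaves-contract s)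

  subtrees-graft : ∀ x y {t} → t ∈ maybeSubtrees (graft x y) →
                   graft x y ≡ just t ⊎ t ∈ maybeSubtrees x ⊎ t ∈ maybeSubtrees y
  subtrees-graft (just l) (just r) (here refl) = inj₁ refl
  subtrees-graft (just l) (just r) (there q) with ∈-++⁻ (subtrees l) q
  ... | inj₁ q′ = inj₂ (inj₁ q′)
  ... | inj₂ q′ = inj₂ (inj₂ q′)
  subtrees-graft (just l) nothing q = inj₂ (inj₁ q)
  subtrees-graft nothing  y       q = inj₂ (inj₂ q)

  subtrees-contract : ∀ s {t} → t ∈ maybeSubtrees (contract s) → ∃ λ s′ → s′ ∈ subtrees s × contract s′ ≡ just t
  subtrees-contract (leaf (inj₁ i)) (here refl) = leaf (inj₁ i) , here refl , refl
  subtrees-contract (node l r) q with subtrees-graft (contract l) (contract r) q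
  ... | inj₁ e = node l r , here refl , e
  ... | inj₂ (inj₁ q′) with subtrees-contract l q′
  ...   | s′ , p , e = s′ , there (∈-++⁺ˡ p) , e
  subtrees-contract (node l r) q | inj₂ (inj₂ q′) with subtrees-contract r q′
  ...   | s′ , p , e = s′ , there (∈-++⁺ʳ (subtrees l) p) , e

  shore-contract : ∀ s {t} → contract s ≡ just t → ∀ i → shore F._≟_ t i ≡ shore _≟G_ s (inj₁ i)
  shore-contract s {t} e i = memB-cong F._≟_ _≟G_ i (leaves t) (inj₁ i) (leaves s)
    (λ p → ∈-aIndices⁻ (leaves s) (subst (i ∈_) (leaves-contract-just s e) p))
    (λ p → subst (i ∈_) (sym (leaves-contract-just s e)) (∈-aIndices⁺ (leaves s) p))

  contract-just : ∀ s i → inj₁ i ∈ leaves s → ∃ λ t → contract s ≡ just t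
  contract-just s i p with contract s in e
  ... | just t  = t , refl
  ... | nothing with () ← subst (i ∈_) (trans (sym (leaves-contract s)) (cong maybeLeaves e)) (∈-aIndices⁺ (leaves s) p)

module Isolation {m : ℕ} (μ : Fin m → Fin m) (2≤m : 2 ≤ m) (d : Decomp (VG m))
                 (union : ∀ {s} → s ∈ innerSubtrees (body d) → UnionOfMEdges μ (shore _≟G_ s)) where
  open DecompProperties _≟G_ d public

  at-least-3-leaves : ∀ {n} → length (leaves (body d)) ≡ n → n ≤ 2 → ⊥
  at-least-3-leaves e n≤2 =
    1+n≰n (≤-trans (subst (3 ≤_) e (≤-pred (4≤covering-length 2≤m (root d ∷ leaves (body d)) (cover d)))) n≤2)

  data Ends (i : Fin m) : VG m → VG m → Set where
    ab : Ends i (inj₁ i) (inj₂ (μ i))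
    ba : Ends i (inj₂ (μ i)) (inj₁ i)

  ends-swap : ∀ {i w w′} → Ends i w w′ → Ends i w′ w
  ends-swap ab = ba
  ends-swap ba = ab

  ends-≢ : ∀ {i w w′} → Ends i w w′ → w ≢ w′
  ends-≢ ab ()
  ends-≢ ba ()

  ends-index : ∀ {i w w′} → Ends i w w′ → ∀ {j} → inj₁ j ≡ w → j ≡ i
  ends-index ab refl = refl

  ends-index′ : ∀ {i w w′} → Ends i w w′ → ∀ {j} → inj₁ j ≡ w′ → j ≡ i
  ends-index′ = ends-index ∘ ends-swap

  a∈ends : ∀ {i w w′} → Ends i w w′ → inj₁ i ≡ w ⊎ inj₁ i ≡ w′
  a∈ends ab = inj₁ refl
  a∈ends ba = inj₂ refl

  ends-inner : ∀ {s} → s ∈ innerSubtrees (body d) → ∀ {i w w′} → Ends i w w′ → w ∈ leaves s → w′ ∈ leaves s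
  ends-inner {s} q ab p = memB-true⇒∈ _≟G_ _ (leaves s) (trans (sym (union q _)) (∈⇒memB-true _≟G_ _ (leaves s) p))
  ends-inner {s} q ba p = memB-true⇒∈ _≟G_ _ (leaves s) (trans (union q _) (∈⇒memB-true _≟G_ _ (leaves s) p))

  data Isolating (i : Fin m) : Set where
    singleton   : ∀ s → s ∈ innerSubtrees (body d) →
                  (∀ j → inj₁ j ∈ leaves s → j ≡ i) → inj₁ i ∈ leaves s → Isolating i
    cosingleton : ∀ s → s ∈ innerSubtrees (body d) →
                  (∀ j → inj₁ j ∈ leaves s → j ≢ i) → (∀ j → j ≢ i → inj₁ j ∈ leaves s) → Isolating i

  -- w′ is then the root leaf, and the sibling of w carries every other vertex.
  parentIsBody : ∀ {i w w′ t} → Ends i w w′ → HasLeafChild w t (body d) → Isolating i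
  parentIsBody {t = leaf x} ends child = ⊥-elim (at-least-3-leaves (length-parent child) ≤-refl)
  parentIsBody {i} {w} {w′} {t = node t₁ t₂} ends child = cosingleton t t-inner avoids-i covers-rest
    where
    t = node t₁ t₂
    t-inner : t ∈ innerSubtrees (body d)
    t-inner = sibling-inner child (here refl)
    w∉t : w ∉ leaves t
    w∉t = leaf∉sibling child unique-body
    w′∉t : w′ ∉ leaves t
    w′∉t = w∉t ∘ ends-inner t-inner (ends-swap ends)
    w′-root : w′ ≡ root d
    w′-root with cover d w′
    ... | here e = e
    ... | there p with ∈-parent⁻ child p
    ...   | inj₁ e  = ⊥-elim (ends-≢ ends (sym e))
    ...   | inj₂ p′ = ⊥-elim (w′∉t p′)
    avoids-i : ∀ j → inj₁ j ∈ leaves t → j ≢ i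
    avoids-i j p refl with a∈ends ends
    ... | inj₁ e = w∉t (subst (_∈ leaves t) e p)
    ... | inj₂ e = w′∉t (subst (_∈ leaves t) e p)
    covers-rest : ∀ j → j ≢ i → inj₁ j ∈ leaves t
    covers-rest j j≢i with ∈-parent⁻ child (∈-body (inj₁ j) (j≢i ∘ ends-index′ ends ∘ flip-root))
      where
      flip-root : inj₁ j ≡ root d → inj₁ j ≡ w′
      flip-root e = trans e (sym w′-root)
    ... | inj₁ e = ⊥-elim (j≢i (ends-index ends e))
    ... | inj₂ p = p

  -- The sibling of w must then be the leaf w′.
  parentIsInner : ∀ {i w w′ p t} → Ends i w w′ → p ∈ innerSubtrees (body d) → HasLeafChild w t p → Isolating i
  parentIsInner {i} {w} {w′} {p} {leaf x} ends p-inner child = singleton p p-inner only-i has-i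
    where
    w′∈p : w′ ∈ leaves p
    w′∈p = ends-inner p-inner ends (leaf∈parent child)
    x≡w′ : x ≡ w′
    x≡w′ with ∈-parent⁻ child w′∈p
    ... | inj₁ e         = ⊥-elim (ends-≢ ends (sym e))
    ... | inj₂ (here e)  = sym e
    only-i : ∀ j → inj₁ j ∈ leaves p → j ≡ i
    only-i j q with ∈-parent⁻ child q
    ... | inj₁ e        = ends-index ends e
    ... | inj₂ (here e) = ends-index′ ends (trans e x≡w′)
    has-i : inj₁ i ∈ leaves p
    has-i with a∈ends ends
    ... | inj₁ e = subst (_∈ leaves p) (sym e) (leaf∈parent child)
    ... | inj₂ e = subst (_∈ leaves p) (sym e) w′∈p
  parentIsInner {i} {w} {w′} {p} {node t₁ t₂} ends p-inner child =
    ⊥-elim (leaf∉sibling child unique-p (ends-inner t-inner (ends-swap ends) w′∈t))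
    where
    p∈body : p ∈ subtrees (body d)
    p∈body = innerSubtrees⊆subtrees (body d) p-inner
    unique-p : Unique (leaves p)
    unique-p = unique-subtree p∈body unique-body
    t-inner : node t₁ t₂ ∈ innerSubtrees (body d)
    t-inner = nodeSubtrees-innerSubtrees-trans (body d)
                (innerSubtrees⊆nodeSubtrees p (sibling-inner child (here refl))) p-inner
    w′∈t : w′ ∈ leaves (node t₁ t₂)
    w′∈t with ∈-parent⁻ child (ends-inner p-inner ends (leaf∈parent child))
    ... | inj₁ e = ⊥-elim (ends-≢ ends (sym e))
    ... | inj₂ q = q

  isolating′ : ∀ {i w w′} → Ends i w w′ → w ≢ root d → Isolating i
  isolating′ {w = w} ends w≢root with findParent w (body d) (∈-body w w≢root)
  ... | inj₁ body≡leaf = ⊥-elim (at-least-3-leaves (cong (length ∘ leaves) body≡leaf) (s≤s z≤n))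
  ... | inj₂ (p , t , p∈ , child) with nodeSubtrees-top-or-inner (body d) p∈
  ...   | inj₁ refl    = parentIsBody ends child
  ...   | inj₂ p-inner = parentIsInner ends p-inner child

  isolating : ∀ i → Isolating i
  isolating i with root d ≟G inj₁ i
  ... | yes root≡a = isolating′ ba (λ e → case (trans e root≡a))
    where
    case : inj₂ (μ i) ≢ inj₁ i
    case ()
  ... | no root≢a  = isolating′ ab (root≢a ∘ sym)

⌊inj₁≟Ginj₁⌋ : ∀ {m} (a b : Fin m) → ⌊ inj₁ {B = Fin m} a ≟G inj₁ b ⌋ ≡ ⌊ a F.≟ b ⌋
⌊inj₁≟Ginj₁⌋ a b with a F.≟ b
... | yes refl = refl
... | no _     = refl

module Contraction {m : ℕ} (E : Fin m → Fin m → Bool) (μ : Fin m → Fin m) (μ-pm : IsPM E μ) (2≤m : 2 ≤ m)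
                   (d : Decomp (VG m)) (k : ℕ) (conformal : MConformalDecomp μ d) (width : PMWidthAtMost E d k) where
  open MatchingCycles E μ μ-pm

  union : ∀ {s} → s ∈ innerSubtrees (body d) → UnionOfMEdges μ (shore _≟G_ s)
  union {s} q = conformal⇒unionOfMEdges (shore _≟G_ s) (proj₁ (All.lookup conformal q))

  open Isolation μ 2≤m d union

  porosity-inner : ∀ {s} → s ∈ innerSubtrees (body d) → PorosityAtMost D (shore _≟G_ s ∘ inj₁) k
  porosity-inner {s} q = mp⇒porosity (shore _≟G_ s) k (union q) (All.lookup width (innerSubtrees⊆subtrees (body d) q))

  porosity-singleton : ∀ i → PorosityAtMost D (λ j → ⌊ i F.≟ j ⌋) k
  porosity-singleton i with isolating i
  ... | singleton s q only-i has-i = PorosityAtMost-cong D pointwise (porosity-inner q)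
    where
    pointwise : ∀ j → shore _≟G_ s (inj₁ j) ≡ ⌊ i F.≟ j ⌋
    pointwise j = ≡⌊⌋ _ (i F.≟ j) (λ e → sym (only-i j (memB-true⇒∈ _≟G_ _ (leaves s) e)))
                                  (λ { refl → ∈⇒memB-true _≟G_ _ (leaves s) has-i })
  ... | cosingleton s q avoids-i covers-rest =
    PorosityAtMost-cong D pointwise (PorosityAtMost-complement D (shore _≟G_ s ∘ inj₁) (porosity-inner q))
    where
    pointwise : ∀ j → not (shore _≟G_ s (inj₁ j)) ≡ ⌊ i F.≟ j ⌋
    pointwise j with i F.≟ j
    ... | yes refl = cong not (∉⇒memB-false _≟G_ _ (leaves s) (λ p → avoids-i i p refl))
    ... | no i≢j   = cong not (∈⇒memB-true _≟G_ _ (leaves s) (covers-rest j (i≢j ∘ sym)))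

  -- With root b_l the body cut separates no two vertices of D.
  porosity-body : PorosityAtMost D (λ j → not ⌊ root d ≟G inj₁ j ⌋) k
  porosity-body with root d
  ... | inj₁ r = PorosityAtMost-cong D (λ j → cong not (sym (⌊inj₁≟Ginj₁⌋ r j)))
                                     (PorosityAtMost-complement D (λ j → ⌊ r F.≟ j ⌋) (porosity-singleton r))
  ... | inj₂ l = λ cs _ → subst (_≤ k) (sym (countList≡0 _ (arcsOf cs) (λ _ → refl))) z≤n

  porosity-contracted : ∀ {s} → s ∈ subtrees (body d) → ∀ {t} → contract s ≡ just t →
                        PorosityAtMost D (shore F._≟_ t) k
  porosity-contracted q e with subtree-node-or-leaf q
  porosity-contracted q refl | inj₂ (inj₁ i , refl) =
    PorosityAtMost-cong D {Y = λ j → ⌊ i F.≟ j ⌋} (λ j → sym (∨-identityʳ _)) (porosity-singleton i)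
  porosity-contracted q ()   | inj₂ (inj₂ _ , refl)
  porosity-contracted {s} q e | inj₁ n with nodeSubtrees-top-or-inner (body d) n
  ... | inj₂ s-inner = PorosityAtMost-cong D (sym ∘ shore-contract s e) (porosity-inner s-inner)
  ... | inj₁ refl    =
    PorosityAtMost-cong D (λ j → trans (sym (shore-body (inj₁ j))) (sym (shore-contract s e j))) porosity-body

  contractedAt : ∀ r s → s ∈ subtrees (body d) →
                 (∀ j → inj₁ j ∈ leaves s → j ≢ r) → (∀ j → j ≢ r → inj₁ j ∈ leaves s) →
                 Σ (Decomp (Fin m)) (λ d′ → CycWidthAtMost D d′ k)
  contractedAt r s s∈ avoids-r covers-rest with another 2≤m r
  ... | r′ , r′≢r with contract-just s r′ (covers-rest r′ r′≢r)
  ...   | t , e = mkDecomp r t unique-t covered , All.tabulate cuts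
    where
    labels : leaves t ≡ aIndices (leaves s)
    labels = leaves-contract-just s e
    unique-t : Unique (r ∷ leaves t)
    unique-t = subst (λ z → Unique (r ∷ z)) (sym labels)
      (¬Any⇒All¬ _ (λ p → avoids-r r (∈-aIndices⁻ (leaves s) p) refl) ∷
       unique-aIndices (leaves s) (unique-subtree s∈ unique-body))
    covered : ∀ j → j ∈ r ∷ leaves t
    covered j with j F.≟ r
    ... | yes refl = here refl
    ... | no j≢r   = there (subst (j ∈_) (sym labels) (∈-aIndices⁺ (leaves s) (covers-rest j j≢r)))
    cuts : ∀ {t′} → t′ ∈ subtrees t → PorosityAtMost D (shore F._≟_ t′) k
    cuts {t′} p with subtrees-contract s (subst (λ z → t′ ∈ maybeSubtrees z) (sym e) p)
    ... | s′ , q , e′ = porosity-contracted (subtrees-trans q s∈) e′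

  -- A root a_r becomes the root v_r; a root b_l is first replaced by the inner edge isolating v_(μ⁻¹ l).
  contracted : Σ (Decomp (Fin m)) (λ d′ → CycWidthAtMost D d′ k)
  contracted with root d in root≡
  ... | inj₁ r = contractedAt r (body d) (subtrees-self (body d))
    (λ j p j≡r → root∉body (subst (_∈ leaves (body d)) (trans (cong inj₁ j≡r) (sym root≡)) p))
    (λ j j≢r → ∈-body (inj₁ j) (λ e → j≢r (inj₁-injective (trans e root≡))))
  ... | inj₂ l with isolating (μ⁻¹ l)
  ...   | singleton s q _ has-i = ⊥-elim (root∉body (subst (_∈ leaves (body d)) b≡root
          (leaves-subtree (innerSubtrees⊆subtrees (body d) q) (ends-inner q ab has-i))))
    where
    b≡root : inj₂ (μ (μ⁻¹ l)) ≡ root d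
    b≡root = trans (cong inj₂ (μ-μ⁻¹ l)) (sym root≡)
  ...   | cosingleton s q avoids-i covers-rest =
    contractedAt (μ⁻¹ l) s (innerSubtrees⊆subtrees (body d) q) avoids-i covers-rest

lemma4p7 : (m : ℕ) (E : Fin m → Fin m → Bool) (μ : Fin m → Fin m) →
    2 ≤ m → MatchingCovered E → IsPM E μ →
    ∀ w → PmwM E μ w ⇔ Cycw (MDirArc E μ) w
lemma4p7 m E μ 2≤m mc μ-pm w = mk⇔ pmw⇒cycw cycw⇒pmw
  where
  open MatchingCycles E μ μ-pm using (D)
  open Expansion E μ μ-pm

  contracted : ∀ d k → MConformalDecomp μ d → PMWidthAtMost E d k →
               Σ (Decomp (Fin m)) (λ d′ → CycWidthAtMost D d′ k)
  contracted d k conformal width = Contraction.contracted E μ μ-pm 2≤m d k conformal width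

  expanded-width : ∀ d k → CycWidthAtMost D d k → PMWidthAtMost E (expandDecomp d) k
  expanded-width d k cw = expandDecomp-width d k (cycWidth-≥1 E μ 2≤m mc μ-pm d k cw) cw

  pmw⇒cycw : PmwM E μ w → Cycw D w
  pmw⇒cycw ((d , conformal , width) , least) =
    contracted d w conformal width ,
    λ d′ k cw → least (expandDecomp d′) k (expandDecomp-conformal d′) (expanded-width d′ k cw)

  cycw⇒pmw : Cycw D w → PmwM E μ w
  cycw⇒pmw ((d′ , cw) , least) =
    (expandDecomp d′ , expandDecomp-conformal d′ , expanded-width d′ w cw) ,
    λ d k conformal width → let d′ , cw′ = contracted d k conformal width in least d′ k cw′
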